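{- Let $\mathbb{F}$ be a field of characteristic $0$, let $n,d$ be positive integers, and let $D$ be a $(d,n)$-correlated diagram. Then, as an $\mathbb{F}\mathrm{S}_{dn}$-module under the diagonal action, $\mathcal{C}(D)$ is isomorphic to the row tabloid module $\mathcal{R}(\delta(D))$.
   Context: $\mathcal{P}(d)$ is the $\mathbb{F}$-vector space spanned by symbols $[S]$ for $d\times n$ arrays $S$ containing each of $1,\dots,dn$ exactly once, subject to: exchanging two entries in the same row multiplies the symbol by $-1$; $\overline{\mathcal{P}}(d)$ is an identical copy with entries written $\bar 1,\dots,\overline{dn}$. $\mathrm{S}_{dn}$ acts diagonally on $\mathcal{P}(d)\otimes\overline{\mathcal{P}}(d)$: $\sigma$ sends $[S]\otimes[\bar T]$ to $[S^\sigma]\otimes[\bar T^\sigma]$, replacing every entry $k$ (resp. $\bar k$) by $\sigma(k)$ (resp. $\overline{\sigma(k)}$). A correlated tableau is a $d\times d$ matrix $C$ of subsets of $[dn]$ such that the $C(i,j)$ partition $[dn]$, each row union $\bigcup_j C(i,j)$ has $n$ elements and each column union $\bigcup_i C(i,j)$ has $n$ elements. To $C$ is associated the element $[S]\otimes[\bar T]$ where row $i$ of $S$ lists the elements of $C(i,1),C(i,2),\dots,C(i,d)$ in this order (elements within one entry in increasing order) and row $j$ of $\bar T$ lists (barred) the elements of $C(1,j),\dots,C(d,j)$ in this order (within one entry increasing). A $(d,n)$-correlated diagram is a $d\times d$ matrix over $\mathbb{N}$ with all row and column sums equal to $n$; the shape of $C$ is the diagram $D_C(i,j)=|C(i,j)|$.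 $\mathcal{C}(D)$ is the span of the elements associated to correlated tableaux of shape $D$. $\delta(D)$ is the partition of $dn$ obtained by arranging the nonzero entries of $D$ in non-increasing order. For a partition $\lambda\vdash s$, a row tabloid of shape $\lambda$ is a filling of the Young diagram of $\lambda$ by $[s]$ without repetition, modulo the equivalence identifying fillings whose corresponding rows contain the same sets of entries; $\mathcal{R}(\lambda)$ is the $\mathbb{F}\mathrm{S}_s$-module spanned by row tabloids of shape $\lambda$, with $\mathrm{S}_s$ permuting entries. -}

module Defs where

open import Level using (Level; _⊔_) renaming (suc to lsuc)
open import Algebra.Bundles using (CommutativeRing)
open import Data.Nat using (ℕ; zero; suc; _≤ᵇ_) renaming (_*_ to _*ℕ_)
open import Data.Bool using (Bool; true; false; if_then_else_)
open import Data.Fin using (Fin) renaming (zero to fzero; suc to fsuc)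
open import Data.Fin.Properties using () renaming (_≟_ to _≟ꟳ_)
open import Data.Fin.Subset using (Subset; ∣_∣; ⋃) renaming (_∈_ to _∈ˢ_)
open import Data.Fin.Permutation using (Permutation′; _⟨$⟩ʳ_; transpose)
open import Data.Vec using ([]; _∷_)
open import Data.List using (List; []; _∷_; [_]; map; length; concat; concatMap; allFin; replicate; _++_)
open import Data.Nat.ListAction using (sum)
open import Data.List.Properties using () renaming (≡-dec to List-≡-dec)
open import Data.List.Membership.Propositional using (_∈_)
open import Data.List.Relation.Unary.Unique.Propositional using (Unique)
open import Data.List.Relation.Unary.Any using (Any)
open import Data.List.Relation.Binary.Pointwise using (Pointwise)
open import Data.List.Relation.Binary.Permutation.Propositional using (_↭_)
open import Data.Product using (Σ; _×_; _,_; proj₁; proj₂)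
open import Data.Product.Properties using () renaming (≡-dec to ×-≡-dec)
open import Data.Sum using (_⊎_)
open import Relation.Nullary using (¬_; yes; no)
open import Relation.Binary.Definitions using (DecidableEquality)
open import Relation.Binary.PropositionalEquality using (_≡_)

record Field (c ℓ : Level) : Set (lsuc (c ⊔ ℓ)) where
  field
    commutativeRing : CommutativeRing c ℓ
  open CommutativeRing commutativeRing public
  field
    1≉0     : ¬ (1# ≈ 0#)
    inverse : ∀ x → ¬ (x ≈ 0#) → Σ Carrier λ y → (x * y) ≈ 1#

natF : ∀ {c ℓ} (F : Field c ℓ) → ℕ → Field.Carrier F
natF F zero    = Field.0# F
natF F (suc m) = Field._+_ F (Field.1# F) (natF F m)

Characteristic0 : ∀ {c ℓ} → Field c ℓ → Set ℓ
Characteristic0 F = ∀ m → ¬ (Field._≈_ F (natF F (suc m)) (Field.0# F))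

module FreeModule {c ℓ} (F : Field c ℓ) (K : Set) (_≟_ : DecidableEquality K) where
  open Field F

  FSum : Set c
  FSum = List (Carrier × K)

  coeff : FSum → K → Carrier
  coeff []             b = 0#
  coeff ((a , x) ∷ xs) b with x ≟ b
  ... | yes _ = a + coeff xs b
  ... | no  _ = coeff xs b

  _≈ᶠ_ : FSum → FSum → Set ℓ
  x ≈ᶠ y = ∀ b → coeff x b ≈ coeff y b

  _⊕_ : FSum → FSum → FSum
  x ⊕ y = x ++ y

  _⊙_ : Carrier → FSum → FSum
  a ⊙ xs = map (λ p → (a * proj₁ p , proj₂ p)) xs

  _⊖_ : FSum → FSum → FSum
  x ⊖ y = x ⊕ ((- 1#) ⊙ y)

  lincomb : List (Carrier × FSum) → FSum
  lincomb = concatMap (λ p → proj₁ p ⊙ proj₂ p)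

  InSpan : {G : Set} → (G → FSum) → FSum → Set (c ⊔ ℓ)
  InSpan {G} gen v =
    Σ (List (Carrier × G)) λ cs → v ≈ᶠ lincomb (map (λ p → (proj₁ p , gen (proj₂ p))) cs)

  QuotEq : {G : Set} → (G → FSum) → FSum → FSum → Set (c ⊔ ℓ)
  QuotEq gen x y = InSpan gen (x ⊖ y)

-- Fillings of Young diagrams / arrays by [s] = Fin s (entries 0..s-1
-- stand for 1..s).  A filling is the list of its rows.

Filling : ℕ → Set
Filling s = List (List (Fin s))

_≟F_ : ∀ {s} → DecidableEquality (Filling s)
_≟F_ = List-≡-dec (List-≡-dec _≟ꟳ_)

ValidFilling : ∀ {s} → List ℕ → Filling s → Set
ValidFilling {s} λs t = (map length t ≡ λs) × Unique (concat t) × (∀ (k : Fin s) → k ∈ concat t)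

SameRow : ∀ {s} → Filling s → Fin s → Fin s → Set
SameRow t a b = Any (λ r → a ∈ r × b ∈ r) t

actF : ∀ {s} → Permutation′ s → Filling s → Filling s
actF σ t = map (map (σ ⟨$⟩ʳ_)) t

sumFin : ∀ d → (Fin d → ℕ) → ℕ
sumFin d f = sum (map f (allFin d))

IsCorrelatedDiagram : ∀ d n → (Fin d → Fin d → ℕ) → Set
IsCorrelatedDiagram d n D = (∀ i → sumFin d (λ j → D i j) ≡ n) × (∀ j → sumFin d (λ i → D i j) ≡ n)

insertDesc : ℕ → List ℕ → List ℕ
insertDesc x []       = x ∷ []
insertDesc x (y ∷ ys) = if y ≤ᵇ x then x ∷ y ∷ ys else y ∷ insertDesc x ys

sortDesc : List ℕ → List ℕ
sortDesc []       = []
sortDesc (x ∷ xs) = insertDesc x (sortDesc xs)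

dropZeros : List ℕ → List ℕ
dropZeros []            = []
dropZeros (zero ∷ xs)   = dropZeros xs
dropZeros (suc x ∷ xs)  = suc x ∷ dropZeros xs

δ : ∀ {d} → (Fin d → Fin d → ℕ) → List ℕ
δ {d} D = sortDesc (dropZeros (concatMap (λ i → map (D i) (allFin d)) (allFin d)))

elems : ∀ {m} → Subset m → List (Fin m)
elems []            = []
elems (true  ∷ p)   = fzero ∷ map fsuc (elems p)
elems (false ∷ p)   = map fsuc (elems p)

record CorrelatedTableau (d n : ℕ) : Set where
  field
    cell      : Fin d → Fin d → Subset (d *ℕ n)
    partition : ∀ (k : Fin (d *ℕ n)) →
                Σ (Fin d × Fin d) λ ij → (k ∈ˢ cell (proj₁ ij) (proj₂ ij)) ×
                  (∀ i j → k ∈ˢ cell i j → (i , j) ≡ ij)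
    rowUnion  : ∀ i → ∣ ⋃ (map (λ j → cell i j) (allFin d)) ∣ ≡ n
    colUnion  : ∀ j → ∣ ⋃ (map (λ i → cell i j) (allFin d)) ∣ ≡ n

open CorrelatedTableau public

HasShape : ∀ {d n} → CorrelatedTableau d n → (Fin d → Fin d → ℕ) → Set
HasShape C D = ∀ i j → ∣ cell C i j ∣ ≡ D i j

-- the pair (S , T) with [S] ⊗ [T̄] the element associated to C
associated : ∀ {d n} → CorrelatedTableau d n → Filling (d *ℕ n) × Filling (d *ℕ n)
associated {d} C =
  ( map (λ i → concatMap (λ j → elems (cell C i j)) (allFin d)) (allFin d)
  , map (λ j → concatMap (λ i → elems (cell C i j)) (allFin d)) (allFin d) )

module Modules {c ℓ} (F : Field c ℓ) (d n : ℕ) where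
  open Field F

  N : ℕ
  N = d *ℕ n

  arrayShape : List ℕ
  arrayShape = replicate d n

  -- P(d) ⊗ P̄(d): presented as the free space on pairs (S , T̄) of arrays
  -- (i.e. on the symbols [S] ⊗ [T̄]) modulo the relations coming from
  -- P(d) and P̄(d); pairs that are not pairs of d×n arrays filled by
  -- [dn] are set to 0 (so the free space is on genuine arrays only).

  PKey : Set
  PKey = Filling N × Filling N

  _≟P_ : DecidableEquality PKey
  _≟P_ = ×-≡-dec _≟F_ _≟F_

  module PP = FreeModule F PKey _≟P_

  data PGen : Set where
    swapL   : (S T : Filling N) → ValidFilling arrayShape S → ValidFilling arrayShape T →
              (a b : Fin N) → ¬ (a ≡ b) → SameRow S a b → PGen
    swapR   : (S T : Filling N) → ValidFilling arrayShape S → ValidFilling arrayShape T →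
              (a b : Fin N) → ¬ (a ≡ b) → SameRow T a b → PGen
    invalid : (S T : Filling N) → ¬ (ValidFilling arrayShape S × ValidFilling arrayShape T) → PGen

  pgen : PGen → PP.FSum
  pgen (swapL S T _ _ a b _ _) = (1# , (S , T)) ∷ (1# , (actF (transpose a b) S , T)) ∷ []
  pgen (swapR S T _ _ a b _ _) = (1# , (S , T)) ∷ (1# , (S , actF (transpose a b) T)) ∷ []
  pgen (invalid S T _)          = (1# , (S , T)) ∷ []

  _≈P_ : PP.FSum → PP.FSum → Set (c ⊔ ℓ)
  _≈P_ = PP.QuotEq pgen

  actP : Permutation′ N → PP.FSum → PP.FSum
  actP σ = map (λ p → (proj₁ p , (actF σ (proj₁ (proj₂ p)) , actF σ (proj₂ (proj₂ p)))))

  TableauOfShape : (Fin d → Fin d → ℕ) → Set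
  TableauOfShape D = Σ (CorrelatedTableau d n) λ C → HasShape C D

  assocElem : ∀ {D} → TableauOfShape D → PP.FSum
  assocElem CT = (1# , associated (proj₁ CT)) ∷ []

  InC : (Fin d → Fin d → ℕ) → PP.FSum → Set (c ⊔ ℓ)
  InC D y = Σ (List (Carrier × TableauOfShape D)) λ cs →
              y ≈P PP.lincomb (map (λ p → (proj₁ p , assocElem (proj₂ p))) cs)

  -- R(λ), λ ⊢ dn: free space on fillings of shape λ modulo identifying
  -- fillings whose corresponding rows contain the same sets of entries;
  -- non-fillings set to 0.

  module RR = FreeModule F (Filling N) _≟F_

  data RGen (λs : List ℕ) : Set where
    rowEq   : (t t' : Filling N) → ValidFilling λs t → ValidFilling λs t' →
              Pointwise _↭_ t t' → RGen λs
    invalid : (t : Filling N) → ¬ ValidFilling λs t → RGen λs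

  rgen : ∀ {λs} → RGen λs → RR.FSum
  rgen (rowEq t t' _ _ _) = (1# , t) ∷ (- 1# , t') ∷ []
  rgen (invalid t _)      = (1# , t) ∷ []

  _≈R[_]_ : RR.FSum → List ℕ → RR.FSum → Set (c ⊔ ℓ)
  x ≈R[ λs ] y = RR.QuotEq (rgen {λs}) x y

  actR : Permutation′ N → RR.FSum → RR.FSum
  actR σ = map (λ p → (proj₁ p , actF σ (proj₂ p)))

  record RC-Iso (λs : List ℕ) (D : Fin d → Fin d → ℕ) : Set (c ⊔ ℓ) where
    field
      φ          : RR.FSum → PP.FSum
      well-def   : ∀ x y → x ≈R[ λs ] y → φ x ≈P φ y
      additive   : ∀ x y → φ (x RR.⊕ y) ≈P (φ x PP.⊕ φ y)
      homogen    : ∀ a x → φ (a RR.⊙ x) ≈P (a PP.⊙ φ x)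
      equivariant : ∀ (σ : Permutation′ N) x → φ (actR σ x) ≈P actP σ (φ x)
      into-C     : ∀ x → InC D (φ x)
      injective  : ∀ x y → φ x ≈P φ y → x ≈R[ λs ] y
      onto-C     : ∀ y → InC D y → Σ RR.FSum λ x → φ x ≈P y

module Submission where

-- List the nonzero cells c₁, c₂, … of D in the order in which δ(D) lists their
-- sizes; row r of a tabloid of shape δ(D) is then "the content of cell c_r".
-- The map φ : R(δ(D)) → P(d) ⊗ P̄(d) places row r of a filling t into cell c_r
-- and reads off the pair of arrays [S] ⊗ [T̄] (row i of S = cells (i,·), row j
-- of T̄ = cells (·,j)).  Permuting the entries of one cell applies the same
-- transposition to S and to T̄, and the two sign changes cancel; hence φ is
-- insensitive to the order inside a row of t (φ is well defined on R), and φ t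
-- equals the element associated to a correlated tableau of shape D (φ lands in
-- C(D), and every associated element is hit).  A left inverse ψ sends a pair of
-- arrays (S , T̄) to ε(S,T̄) · (the tabloid whose row r is row i of S ∩ row j of
-- T̄, for c_r = (i,j)), where the sign ε is an inversion parity that flips
-- under every transposition inside a row; so ψ kills the defining relations of
-- P(d) ⊗ P̄(d), and ψ ∘ φ = id on R(δ(D)) makes φ injective.

open import Defs
open import Level using (Level)
open import Level using (_⊔_)
open import Data.Nat using (ℕ; NonZero)
open import Data.Nat as ℕ using (zero; suc; _≤_; z≤n; s≤s; _≤ᵇ_)
open import Data.Nat.ListAction using (sum)
open import Data.Fin using (Fin)
import Data.Fin as Fin

open import Data.Bool using (Bool; true; false; not; _xor_; if_then_else_)
open import Data.Bool.Properties using (xor-same; xor-comm; xor-∧-commutativeRing; xor-inverseʳ; xor-annihilates-not; not-distribˡ-xor; not-distribʳ-xor)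
open import Algebra.Bundles using (CommutativeRing)
open import Algebra.Properties.CommutativeSemigroup (CommutativeRing.+-commutativeSemigroup xor-∧-commutativeRing)
  using () renaming (interchange to xor-interchange; x∙yz≈y∙xz to xor-left-comm)
open import Data.Empty using (⊥-elim)
open import Data.Nat.Properties using (≤-trans; ≤-refl; m≤n⇒m≤1+n; 0≢1+n)
open import Data.Fin.Properties using (_≟_; _<?_; <-cmp; suc-injective; all?)
import Data.Fin.Permutation.Components as PermC
open import Data.Fin.Subset using (Subset; ∣_∣; ⋃; _∩_) renaming (_∈_ to _∈ˢ_)
open import Data.Fin.Subset.Properties using (∉⊥; x∈p∪q⁻; x∈p∪q⁺; x∈p∩q⁻; x∈p∩q⁺; ⊆-antisym)
open import Data.List using (List; []; _∷_; map; length; concat; concatMap; _++_; allFin; replicate; tabulate)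
open import Data.List.Properties using (≡-dec; length-map; length-++; map-id; map-id-local; map-cong; map-cong-local; map-∘; map-++; concatMap-++; concatMap-map; map-concatMap; concatMap-cong; concat-map; ∷-injective; ++-assoc)
open import Data.List.Membership.Propositional using (_∈_; _∉_; find; lose)
open import Data.List.Membership.Propositional.Properties using (∈-concat⁺′; ∈-allFin; ∈-map⁺; ∈-map⁻; ∈-++⁺ʳ; ∈-∃++; ∈-concatMap⁺; ∈-concatMap⁻)
open import Data.List.Membership.Propositional.Properties.WithK using (unique∧set⇒bag)
import Data.List.Membership.DecPropositional as DecMembership
open import Data.List.Relation.Unary.All as All using (All; []; _∷_)
open import Data.List.Relation.Unary.All.Properties using (++⁻ˡ; ++⁻ʳ)
open import Data.List.Relation.Unary.Any as Any using (Any; here; there)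
import Data.List.Relation.Unary.Any.Properties as Any
open import Data.List.Relation.Binary.Pointwise using (Pointwise; []; _∷_)
open import Data.List.Relation.Unary.AllPairs using ([]; _∷_)
open import Data.List.Relation.Unary.Unique.Propositional using (Unique)
import Data.List.Relation.Unary.Unique.Propositional.Properties as Unique
import Data.List.Relation.Unary.Unique.DecPropositional as UniqueDec
open import Data.List.Relation.Binary.BagAndSetEquality using (∼bag⇒↭)
open import Data.List.Relation.Binary.Permutation.Propositional as ↭ using (_↭_; ↭-refl; ↭-sym; ↭-trans; ↭-prep; ↭⇒↭ₛ)
open import Data.List.Relation.Binary.Permutation.Propositional.Properties using (∈-resp-↭; ↭-length; shift; shifts; ++⁺ˡ; ++⁺) renaming (map⁺ to ↭-map⁺)
import Data.List.Relation.Binary.Permutation.Setoid.Properties as PermutationSetoid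
open import Data.Product using (Σ; _×_; _,_; proj₁; proj₂)
open import Data.Product.Properties using (,-injective) renaming (≡-dec to ×-≡-dec)
open import Data.Sum using (_⊎_; inj₁; inj₂; [_,_]′)
open import Data.Vec as Vec using ([]; _∷_; here; there)
open import Data.Vec.Properties using (lookup∘tabulate; []=⇒lookup; lookup⇒[]=)
open import Function.Base using (_∘′_)
open import Function.Bundles using (mk⇔)
open import Relation.Nullary using (¬_; Dec; yes; no; does; _×-dec_)
open import Relation.Nullary.Decidable using (dec-true; dec-false)
open import Relation.Binary using (tri<; tri≈; tri>)
open import Relation.Binary.Definitions using (DecidableEquality)
open import Relation.Binary.PropositionalEquality as ≡ using (_≡_; _≢_; refl; cong; cong₂; subst)

private variable
  A B : Set

-- Splitting a duplicate-free concatenation gives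
-- duplicate-free, disjoint pieces; this is how disjointness of the cells of a
-- correlated tableau is read off from the validity of its arrays.

unique-++⁻ : ∀ (xs : List A) {ys} → Unique (xs ++ ys) →
             Unique xs × Unique ys × (∀ {x} → x ∈ xs → x ∉ ys)
unique-++⁻ []       u          = [] , u , λ ()
unique-++⁻ (x ∷ xs) (x∉ ∷ u) with unique-++⁻ xs u
... | uxs , uys , disj = (++⁻ˡ xs x∉ ∷ uxs) , uys , λ where
  (here refl) y∈ → All.lookup (++⁻ʳ xs x∉) y∈ refl
  (there x∈)  y∈ → disj x∈ y∈

↭-remove : ∀ {x : A} {xs} → x ∈ xs → Σ (List A) λ ys → xs ↭ x ∷ ys
↭-remove {x = x} x∈ with ∈-∃++ x∈
... | as , bs , refl = as ++ bs , shift x as bs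

unique-resp-↭ : ∀ {xs ys : List A} → xs ↭ ys → Unique xs → Unique ys
unique-resp-↭ {A} p = PermutationSetoid.Unique-resp-↭ (≡.setoid A) (↭⇒↭ₛ p)

unique-same-↭ : ∀ {xs ys : List A} → Unique xs → Unique ys →
                (∀ {z} → z ∈ xs → z ∈ ys) → (∀ {z} → z ∈ ys → z ∈ xs) → xs ↭ ys
unique-same-↭ u v f g = ∼bag⇒↭ (unique∧set⇒bag u v (mk⇔ f g))

concat-↭ : ∀ {xss yss : List (List A)} → Pointwise _↭_ xss yss → concat xss ↭ concat yss
concat-↭ []       = ↭-refl
concat-↭ (p ∷ ps) = ++⁺ p (concat-↭ ps)

map-tabulate-const : ∀ {d} (h : A → ℕ) (g : Fin d → A) n → (∀ i → h (g i) ≡ n) → map h (tabulate g) ≡ replicate d n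
map-tabulate-const {d = zero}  h g n e = refl
map-tabulate-const {d = suc d} h g n e = cong₂ _∷_ (e Fin.zero) (map-tabulate-const h (λ i → g (Fin.suc i)) n (λ i → e (Fin.suc i)))

map-tabulate-const⁻ : ∀ {d} (h : A → ℕ) (g : Fin d → A) n → map h (tabulate g) ≡ replicate d n → ∀ i → h (g i) ≡ n
map-tabulate-const⁻ {d = suc d} h g n e Fin.zero    = proj₁ (∷-injective e)
map-tabulate-const⁻ {d = suc d} h g n e (Fin.suc i) = map-tabulate-const⁻ h (λ i → g (Fin.suc i)) n (proj₂ (∷-injective e)) i

length-zero : ∀ {xs : List A} → length xs ≡ 0 → xs ≡ []
length-zero {xs = []} _ = refl

length-concatMap : ∀ (f : A → List B) xs → length (concatMap f xs) ≡ sum (map (λ x → length (f x)) xs)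
length-concatMap f []       = refl
length-concatMap f (x ∷ xs) = ≡.trans (length-++ (f x)) (cong (length (f x) ℕ.+_) (length-concatMap f xs))

∈-concatMap-intro : ∀ (f : A → List B) {xs x k} → x ∈ xs → k ∈ f x → k ∈ concatMap f xs
∈-concatMap-intro f x∈ k∈ = ∈-concatMap⁺ f (lose x∈ k∈)

∈-concatMap-elim : ∀ (f : A → List B) {xs k} → k ∈ concatMap f xs → Σ A λ x → x ∈ xs × k ∈ f x
∈-concatMap-elim f k∈ = find (∈-concatMap⁻ f k∈)

concatMap-↭ : ∀ (f : A → List B) {xs ys} → xs ↭ ys → concatMap f xs ↭ concatMap f ys
concatMap-↭ f ↭.refl          = ↭-refl
concatMap-↭ f (↭.prep x p)    = ++⁺ˡ (f x) (concatMap-↭ f p)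
concatMap-↭ f (↭.swap x y p)  = ↭-trans (shifts (f x) (f y)) (++⁺ˡ (f y) (++⁺ˡ (f x) (concatMap-↭ f p)))
concatMap-↭ f (↭.trans p q)   = ↭-trans (concatMap-↭ f p) (concatMap-↭ f q)

unique-concatMap-piece : ∀ (f : A → List B) {xs x} → Unique (concatMap f xs) → x ∈ xs → Unique (f x)
unique-concatMap-piece f {y ∷ xs} u x∈ with unique-++⁻ (f y) u | x∈
... | u-fy , _    , _ | here refl = u-fy
... | _    , u-fs , _ | there x∈′ = unique-concatMap-piece f u-fs x∈′

unique-concatMap-disjoint : ∀ (f : A → List B) {xs x y k} → Unique (concatMap f xs) →
                            x ∈ xs → y ∈ xs → k ∈ f x → k ∈ f y → x ≡ y
unique-concatMap-disjoint f {z ∷ xs} u x∈ y∈ kx ky with unique-++⁻ (f z) u | x∈ | y∈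
... | _ , _    , _    | here refl | here refl = refl
... | _ , _    , disj | here refl | there y∈′ = ⊥-elim (disj kx (∈-concatMap-intro f y∈′ ky))
... | _ , _    , disj | there x∈′ | here refl = ⊥-elim (disj ky (∈-concatMap-intro f x∈′ kx))
... | _ , u-fs , _    | there x∈′ | there y∈′ = unique-concatMap-disjoint f u-fs x∈′ y∈′ kx ky

unique-concatMap⁺ : ∀ (f : A → List B) {xs} → Unique xs → (∀ {x} → x ∈ xs → Unique (f x)) →
                    (∀ {x y k} → x ∈ xs → y ∈ xs → k ∈ f x → k ∈ f y → x ≡ y) →
                    Unique (concatMap f xs)
unique-concatMap⁺ f {[]}     _          _  _    = []
unique-concatMap⁺ f {x ∷ xs} (x∉ ∷ uxs) uf disj =
  Unique.++⁺ (uf (here refl)) (unique-concatMap⁺ f uxs (λ m → uf (there m)) (λ a b → disj (there a) (there b)))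
    λ (k∈fx , k∈rest) → let (y , y∈ , k∈fy) = ∈-concatMap-elim f k∈rest in
      All.lookup x∉ y∈ (disj (here refl) (there y∈) k∈fx k∈fy)

module _ (_≟ᴬ_ : DecidableEquality A) (f : A → List B) where

  concatMap-restrict : ∀ {Q ps : List A} → Unique Q → Unique ps → (∀ {p} → p ∈ ps → p ∈ Q) →
                       (∀ {q} → q ∈ Q → q ∉ ps → f q ≡ []) → concatMap f Q ↭ concatMap f ps
  concatMap-restrict {[]}    {[]}    _ _ _ _ = ↭-refl
  concatMap-restrict {[]}    {p ∷ _} _ _ sub _ with sub (here refl)
  ... | ()
  concatMap-restrict {q ∷ Q} {ps} (q∉Q ∷ uQ) uP sub van with DecMembership._∈?_ _≟ᴬ_ q ps
  ... | no q∉ps =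
    subst (_↭ concatMap f ps) (cong (_++ concatMap f Q) (≡.sym (van (here refl) q∉ps)))
      (concatMap-restrict uQ uP sub′ (λ m → van (there m)))
    where
    sub′ : ∀ {p} → p ∈ ps → p ∈ Q
    sub′ m with sub m
    ... | here refl = ⊥-elim (q∉ps m)
    ... | there m′  = m′
  ... | yes q∈ps with ∈-∃++ q∈ps
  ... | as , bs , refl with unique-resp-↭ (shift q as bs) uP
  ... | q∉rest ∷ uRest =
    ↭-trans (++⁺ˡ (f q) (concatMap-restrict uQ uRest sub′ van′)) (↭-sym (concatMap-↭ f (shift q as bs)))
    where
    sub′ : ∀ {p} → p ∈ as ++ bs → p ∈ Q
    sub′ m with sub (∈-resp-↭ (↭-sym (shift q as bs)) (there m))
    ... | here refl = ⊥-elim (All.lookup q∉rest m refl)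
    ... | there m′  = m′
    van′ : ∀ {r} → r ∈ Q → r ∉ as ++ bs → f r ≡ []
    van′ {r} r∈Q r∉ = van (there r∈Q) r∉ps
      where
      r∉ps : r ∉ as ++ q ∷ bs
      r∉ps r∈ps with ∈-resp-↭ (shift q as bs) r∈ps
      ... | here refl = All.lookup q∉Q r∈Q refl
      ... | there m   = r∉ m

-- Finite subsets of [m] and their duplicate-free lists of elements: a
-- correlated tableau stores subsets, its associated arrays store lists.

private variable
  m : ℕ

fromList : List (Fin m) → Subset m
fromList l = Vec.tabulate (λ k → does (DecMembership._∈?_ _≟_ k l))

∈-fromList⁺ : ∀ {k : Fin m} {l} → k ∈ l → k ∈ˢ fromList l
∈-fromList⁺ {k = k} {l} k∈ =
  lookup⇒[]= k (fromList l) (≡.trans (lookup∘tabulate _ k) (dec-true (DecMembership._∈?_ _≟_ k l) k∈))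

∈-fromList⁻ : ∀ {k : Fin m} l → k ∈ˢ fromList l → k ∈ l
∈-fromList⁻ {k = k} l k∈ with DecMembership._∈?_ _≟_ k l
                            | ≡.trans (≡.sym (lookup∘tabulate (λ k → does (DecMembership._∈?_ _≟_ k l)) k)) ([]=⇒lookup k∈)
... | yes k∈l | _ = k∈l
... | no  _   | ()

∈-elems⁺ : ∀ {k : Fin m} (s : Subset m) → k ∈ˢ s → k ∈ elems s
∈-elems⁺ (true  ∷ s) here      = here refl
∈-elems⁺ (true  ∷ s) (there p) = there (∈-map⁺ Fin.suc (∈-elems⁺ s p))
∈-elems⁺ (false ∷ s) (there p) = ∈-map⁺ Fin.suc (∈-elems⁺ s p)

∈-elems⁻ : ∀ {k : Fin m} (s : Subset m) → k ∈ elems s → k ∈ˢ s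
∈-elems⁻ {k = Fin.zero} (true ∷ s) (here refl) = here
∈-elems⁻ {k = Fin.zero} (true ∷ s) (there p) with ∈-map⁻ Fin.suc p
... | _ , _ , ()
∈-elems⁻ {k = Fin.zero} (false ∷ s) p with ∈-map⁻ Fin.suc p
... | _ , _ , ()
∈-elems⁻ {k = Fin.suc k} (true ∷ s) (there p) with ∈-map⁻ Fin.suc p
... | _ , k∈ , refl = there (∈-elems⁻ s k∈)
∈-elems⁻ {k = Fin.suc k} (false ∷ s) p with ∈-map⁻ Fin.suc p
... | _ , k∈ , refl = there (∈-elems⁻ s k∈)

unique-elems : (s : Subset m) → Unique (elems s)
unique-elems []          = []
unique-elems (true  ∷ s) = All.tabulate zero∉ ∷ Unique.map⁺ suc-injective (unique-elems s)
  where
  zero∉ : ∀ {k} → k ∈ map Fin.suc (elems s) → Fin.zero ≢ k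
  zero∉ k∈ refl with ∈-map⁻ Fin.suc k∈
  ... | _ , _ , ()
unique-elems (false ∷ s) = Unique.map⁺ suc-injective (unique-elems s)

card-elems : (s : Subset m) → ∣ s ∣ ≡ length (elems s)
card-elems []          = refl
card-elems (true  ∷ s) = cong suc (≡.trans (card-elems s) (≡.sym (length-map Fin.suc (elems s))))
card-elems (false ∷ s) = ≡.trans (card-elems s) (≡.sym (length-map Fin.suc (elems s)))

fromList-ext : ∀ {l l′ : List (Fin m)} → (∀ {k} → k ∈ l → k ∈ l′) → (∀ {k} → k ∈ l′ → k ∈ l) →
               fromList l ≡ fromList l′
fromList-ext {l = l} {l′} f g =
  ⊆-antisym (λ k∈ → ∈-fromList⁺ (f (∈-fromList⁻ l k∈))) (λ k∈ → ∈-fromList⁺ (g (∈-fromList⁻ l′ k∈)))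

fromList-elems : (s : Subset m) → fromList (elems s) ≡ s
fromList-elems s = ⊆-antisym (λ k∈ → ∈-elems⁻ s (∈-fromList⁻ (elems s) k∈)) (λ k∈ → ∈-fromList⁺ (∈-elems⁺ s k∈))

elems-fromList-↭ : ∀ {l : List (Fin m)} → Unique l → elems (fromList l) ↭ l
elems-fromList-↭ {l = l} u = unique-same-↭ (unique-elems (fromList l)) u
  (λ k∈ → ∈-fromList⁻ l (∈-elems⁻ _ k∈)) (λ k∈ → ∈-elems⁺ (fromList l) (∈-fromList⁺ k∈))

card-fromList : ∀ {l : List (Fin m)} → Unique l → ∣ fromList l ∣ ≡ length l
card-fromList {l = l} u = ≡.trans (card-elems (fromList l)) (↭-length (elems-fromList-↭ u))

∈-⋃⁻ : ∀ {k : Fin m} ss → k ∈ˢ ⋃ ss → Any (k ∈ˢ_) ss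
∈-⋃⁻ []       k∈ = ⊥-elim (∉⊥ k∈)
∈-⋃⁻ (s ∷ ss) k∈ = [ here , (λ k∈′ → there (∈-⋃⁻ ss k∈′)) ]′ (x∈p∪q⁻ s (⋃ ss) k∈)

∈-⋃⁺ : ∀ {k : Fin m} ss → Any (k ∈ˢ_) ss → k ∈ˢ ⋃ ss
∈-⋃⁺ (s ∷ ss) (here k∈)  = x∈p∪q⁺ (inj₁ k∈)
∈-⋃⁺ (s ∷ ss) (there k∈) = x∈p∪q⁺ (inj₂ (∈-⋃⁺ ss k∈))

-- Inversion parity.  xorAll p ys is the xor of p over ys, and xorPairs g xs
-- the xor of g x y over all pairs with x before y in xs; for g x y = (y < x)
-- this is the parity of the number of inversions of xs.

xorAll : (A → Bool) → List A → Bool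
xorAll p []       = false
xorAll p (y ∷ ys) = p y xor xorAll p ys

xorPairs : (A → A → Bool) → List A → Bool
xorPairs g []       = false
xorPairs g (x ∷ xs) = xorAll (g x) xs xor xorPairs g xs

xorAll-map : ∀ (p : B → Bool) (f : A → B) ys → xorAll p (map f ys) ≡ xorAll (λ y → p (f y)) ys
xorAll-map p f []       = refl
xorAll-map p f (y ∷ ys) = cong (p (f y) xor_) (xorAll-map p f ys)

xorPairs-map : ∀ (g : B → B → Bool) (f : A → B) xs → xorPairs g (map f xs) ≡ xorPairs (λ x y → g (f x) (f y)) xs
xorPairs-map g f []       = refl
xorPairs-map g f (x ∷ xs) = cong₂ _xor_ (xorAll-map (g (f x)) f xs) (xorPairs-map g f xs)

xorAll-xor : ∀ (p q : A → Bool) ys → xorAll p ys xor xorAll q ys ≡ xorAll (λ y → p y xor q y) ys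
xorAll-xor p q []       = refl
xorAll-xor p q (y ∷ ys) =
  ≡.trans (xor-interchange (p y) _ (q y) _) (cong ((p y xor q y) xor_) (xorAll-xor p q ys))

xorPairs-xor : ∀ (g h : A → A → Bool) xs → xorPairs g xs xor xorPairs h xs ≡ xorPairs (λ x y → g x y xor h x y) xs
xorPairs-xor g h []       = refl
xorPairs-xor g h (x ∷ xs) =
  ≡.trans (xor-interchange (xorAll (g x) xs) _ (xorAll (h x) xs) _)
          (cong₂ _xor_ (xorAll-xor (g x) (h x) xs) (xorPairs-xor g h xs))

xorAll-↭ : ∀ (p : A → Bool) {xs ys} → xs ↭ ys → xorAll p xs ≡ xorAll p ys
xorAll-↭ p ↭.refl         = refl
xorAll-↭ p (↭.prep x r)   = cong (p x xor_) (xorAll-↭ p r)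
xorAll-↭ p (↭.swap x y r) = ≡.trans (xor-left-comm (p x) (p y) _) (cong (λ z → p y xor (p x xor z)) (xorAll-↭ p r))
xorAll-↭ p (↭.trans r r′) = ≡.trans (xorAll-↭ p r) (xorAll-↭ p r′)

xorPairs-↭ : ∀ (g : A → A → Bool) → (∀ u v → g u v ≡ g v u) → ∀ {xs ys} → xs ↭ ys → xorPairs g xs ≡ xorPairs g ys
xorPairs-↭ g sym-g ↭.refl       = refl
xorPairs-↭ g sym-g (↭.prep x r) = cong₂ _xor_ (xorAll-↭ (g x) r) (xorPairs-↭ g sym-g r)
xorPairs-↭ g sym-g (↭.swap {xs} {ys} x y r) = begin
  (g x y xor xorAll (g x) xs) xor (xorAll (g y) xs xor xorPairs g xs)
    ≡⟨ xor-interchange (g x y) (xorAll (g x) xs) (xorAll (g y) xs) (xorPairs g xs) ⟩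
  (g x y xor xorAll (g y) xs) xor (xorAll (g x) xs xor xorPairs g xs)
    ≡⟨ cong₂ (λ u v → (u xor xorAll (g y) xs) xor (xorAll (g x) xs xor v)) (sym-g x y) (xorPairs-↭ g sym-g r) ⟩
  (g y x xor xorAll (g y) xs) xor (xorAll (g x) xs xor xorPairs g ys)
    ≡⟨ cong₂ (λ u v → (g y x xor u) xor (v xor xorPairs g ys)) (xorAll-↭ (g y) r) (xorAll-↭ (g x) r) ⟩
  (g y x xor xorAll (g y) ys) xor (xorAll (g x) ys xor xorPairs g ys) ∎
  where open ≡.≡-Reasoning
xorPairs-↭ g sym-g (↭.trans r r′) = ≡.trans (xorPairs-↭ g sym-g r) (xorPairs-↭ g sym-g r′)

xorAll-cong : ∀ {p q : A → Bool} {ys} → All (λ y → p y ≡ q y) ys → xorAll p ys ≡ xorAll q ys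
xorAll-cong []       = refl
xorAll-cong (e ∷ es) = cong₂ _xor_ e (xorAll-cong es)

xorAll-false : ∀ {p : A → Bool} {ys} → All (λ y → p y ≡ false) ys → xorAll p ys ≡ false
xorAll-false []       = refl
xorAll-false (e ∷ es) = cong₂ _xor_ e (xorAll-false es)

xorPairs-false : ∀ (g : A → A → Bool) (Q : A → Set) → (∀ {u v} → Q u → Q v → g u v ≡ false) →
                 ∀ {zs} → All Q zs → xorPairs g zs ≡ false
xorPairs-false g Q vanish []         = refl
xorPairs-false g Q vanish (qz ∷ qzs) = cong₂ _xor_ (xorAll-false (All.map (vanish qz) qzs)) (xorPairs-false g Q vanish qzs)

_<ᵇ_ : Fin m → Fin m → Bool
x <ᵇ y = does (x <? y)

<ᵇ-flip : ∀ {x y : Fin m} → x ≢ y → y <ᵇ x ≡ not (x <ᵇ y)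
<ᵇ-flip {x = x} {y} x≢y with <-cmp x y
... | tri< x<y _ y≮x = ≡.trans (dec-false (y <? x) y≮x) (cong not (≡.sym (dec-true (x <? y) x<y)))
... | tri≈ _ x≡y _   = ⊥-elim (x≢y x≡y)
... | tri> x≮y _ y<x = ≡.trans (dec-true (y <? x) y<x) (cong not (≡.sym (dec-false (x <? y) x≮y)))

inversionParity : List (Fin m) → Bool
inversionParity = xorPairs (λ x y → y <ᵇ x)

module Transposition {m} (a b : Fin m) (a≢b : a ≢ b) where

  τ : Fin m → Fin m
  τ = PermC.transpose a b

  τa : τ a ≡ b
  τa rewrite dec-true (a ≟ a) refl = refl

  τb : τ b ≡ a
  τb rewrite dec-false (b ≟ a) (λ e → a≢b (≡.sym e)) | dec-true (b ≟ b) refl = refl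

  τ-fixed : ∀ {z} → z ≢ a → z ≢ b → τ z ≡ z
  τ-fixed {z} z≢a z≢b rewrite dec-false (z ≟ a) z≢a | dec-false (z ≟ b) z≢b = refl

  τ-involutive : ∀ z → τ (τ z) ≡ z
  τ-involutive z = by-cases (z ≟ a) (z ≟ b)
    where
    by-cases : Dec (z ≡ a) → Dec (z ≡ b) → τ (τ z) ≡ z
    by-cases (yes z≡a) _         = ≡.trans (cong (λ w → τ (τ w)) z≡a) (≡.trans (cong τ τa) (≡.trans τb (≡.sym z≡a)))
    by-cases (no _)    (yes z≡b) = ≡.trans (cong (λ w → τ (τ w)) z≡b) (≡.trans (cong τ τb) (≡.trans τa (≡.sym z≡b)))
    by-cases (no z≢a)  (no z≢b)  = ≡.trans (cong τ (τ-fixed z≢a z≢b)) (τ-fixed z≢a z≢b)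

  τ-injective : ∀ {x y} → τ x ≡ τ y → x ≡ y
  τ-injective {x} {y} e = ≡.trans (≡.sym (τ-involutive x)) (≡.trans (cong τ e) (τ-involutive y))

  -- the change of order of x , y under τ; symmetric because τ is injective
  flipped : Fin m → Fin m → Bool
  flipped x y = τ y <ᵇ τ x xor y <ᵇ x

  flipped-sym : ∀ u v → flipped u v ≡ flipped v u
  flipped-sym u v with u ≟ v
  ... | yes refl = refl
  ... | no u≢v   = ≡.trans (cong₂ _xor_ (<ᵇ-flip (λ e → u≢v (τ-injective e))) (<ᵇ-flip u≢v))
                           (xor-annihilates-not (τ u <ᵇ τ v) (u <ᵇ v))

  flipped-ab : flipped a b ≡ true
  flipped-ab rewrite τa | τb = ≡.trans (cong (a <ᵇ b xor_) (<ᵇ-flip a≢b)) (xor-inverseʳ (a <ᵇ b))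

  -- On a ∷ b ∷ R with R avoiding a and b only the pair (a , b) is flipped:
  -- every z in R has the same order relations to a and b before and after τ.
  flipped-parity : ∀ {R} → All (λ z → z ≢ a × z ≢ b) R → xorPairs flipped (a ∷ b ∷ R) ≡ true
  flipped-parity {R} avoid = begin
    (flipped a b xor xorAll (flipped a) R) xor (xorAll (flipped b) R xor xorPairs flipped R)
      ≡⟨ cong₂ (λ x y → (x xor xorAll (flipped a) R) xor (xorAll (flipped b) R xor y))
               flipped-ab (xorPairs-false flipped _ flipped-fixed avoid) ⟩
    (true xor xorAll (flipped a) R) xor (xorAll (flipped b) R xor false)
      ≡⟨ cong (λ x → (true xor x) xor (xorAll (flipped b) R xor false)) (xorAll-cong (All.map same-order avoid)) ⟩
    (true xor xorAll (flipped b) R) xor (xorAll (flipped b) R xor false)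
      ≡⟨ cancel (xorAll (flipped b) R) ⟩
    true ∎
    where
    open ≡.≡-Reasoning
    flipped-fixed : ∀ {u v} → u ≢ a × u ≢ b → v ≢ a × v ≢ b → flipped u v ≡ false
    flipped-fixed {u} {v} (u≢a , u≢b) (v≢a , v≢b) rewrite τ-fixed u≢a u≢b | τ-fixed v≢a v≢b = xor-same (v <ᵇ u)
    same-order : ∀ {z} → z ≢ a × z ≢ b → flipped a z ≡ flipped b z
    same-order {z} (z≢a , z≢b) rewrite τ-fixed z≢a z≢b | τa | τb = xor-comm (z <ᵇ b) (z <ᵇ a)
    cancel : ∀ s → (true xor s) xor (s xor false) ≡ true
    cancel false = refl
    cancel true  = refl

  inversionParity-τ : ∀ {L} → Unique L → a ∈ L → b ∈ L → inversionParity (map τ L) ≡ not (inversionParity L)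
  inversionParity-τ {L} u a∈ b∈ with ↭-remove a∈
  ... | L′ , L↭aL′ with ∈-resp-↭ L↭aL′ b∈
  ...   | here b≡a  = ⊥-elim (a≢b (≡.sym b≡a))
  ...   | there b∈′ with ↭-remove b∈′
  ...     | R , L′↭bR with unique-resp-↭ (↭-trans L↭aL′ (↭-prep a L′↭bR)) u
  ...       | a∉ ∷ b∉ ∷ _ = xor-true (begin
    inversionParity (map τ L) xor inversionParity L
      ≡⟨ cong (_xor inversionParity L) (xorPairs-map (λ x y → y <ᵇ x) τ L) ⟩
    xorPairs (λ x y → τ y <ᵇ τ x) L xor inversionParity L
      ≡⟨ xorPairs-xor _ _ L ⟩
    xorPairs flipped L
      ≡⟨ xorPairs-↭ flipped flipped-sym (↭-trans L↭aL′ (↭-prep a L′↭bR)) ⟩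
    xorPairs flipped (a ∷ b ∷ R)
      ≡⟨ flipped-parity (All.tabulate λ z∈ → (λ z≡a → All.lookup a∉ (there z∈) (≡.sym z≡a)) ,
                                             (λ z≡b → All.lookup b∉ z∈ (≡.sym z≡b))) ⟩
    true ∎)
    where
    open ≡.≡-Reasoning
    xor-true : ∀ {p q} → p xor q ≡ true → p ≡ not q
    xor-true {false} {true}  _ = refl
    xor-true {true}  {false} _ = refl

module SignFacts {c ℓ} (F : Field c ℓ) where
  open Field F
  open import Algebra.Properties.Ring ring using (-1*x≈-x)
  open import Algebra.Properties.Group +-group using (⁻¹-involutive)
  open import Relation.Binary.Reasoning.Setoid setoid

  x-x≈0 : ∀ x → x + (- 1#) * x ≈ 0#
  x-x≈0 x = begin
    x + (- 1#) * x       ≈⟨ +-congʳ (sym (*-identityˡ x)) ⟩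
    1# * x + (- 1#) * x  ≈⟨ sym (distribʳ x 1# (- 1#)) ⟩
    (1# + - 1#) * x      ≈⟨ *-congʳ (-‿inverseʳ 1#) ⟩
    0# * x               ≈⟨ zeroˡ x ⟩
    0#                   ∎

  -1*-1≈1 : (- 1#) * (- 1#) ≈ 1#
  -1*-1≈1 = trans (-1*x≈-x (- 1#)) (⁻¹-involutive 1#)

module FormalSums {c ℓ} (F : Field c ℓ) (K : Set) (_≟ᴷ_ : DecidableEquality K) where
  open Field F renaming (refl to ≈-refl)
  open FreeModule F K _≟ᴷ_
  open SignFacts F
  open import Algebra.Solver.Ring.NaturalCoefficients.Default commutativeSemiring using (solve; _:+_; _:*_; _:=_; con)
  open import Relation.Binary.Reasoning.Setoid setoid

  δᵏ : K → K → Carrier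
  δᵏ k b = coeff ((1# , k) ∷ []) b

  coeff-∷ : ∀ a k z b → coeff ((a , k) ∷ z) b ≈ a * δᵏ k b + coeff z b
  coeff-∷ a k z b with k ≟ᴷ b
  ... | yes _ = +-congʳ (sym (trans (*-congˡ (+-identityʳ 1#)) (*-identityʳ a)))
  ... | no  _ = sym (trans (+-congʳ (zeroʳ a)) (+-identityˡ _))

  ∷-cong : ∀ {a a′} k {x y} → a ≈ a′ → x ≈ᶠ y → ((a , k) ∷ x) ≈ᶠ ((a′ , k) ∷ y)
  ∷-cong {a} {a′} k {x} {y} a≈a′ x≈y b = trans (coeff-∷ a k x b) (trans (+-cong (*-congʳ a≈a′) (x≈y b)) (sym (coeff-∷ a′ k y b)))

  coeff-++ : ∀ (x y : FSum) b → coeff (x ⊕ y) b ≈ coeff x b + coeff y b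
  coeff-++ []            y b = sym (+-identityˡ _)
  coeff-++ ((a , k) ∷ x) y b with k ≟ᴷ b
  ... | yes _ = trans (+-congˡ (coeff-++ x y b)) (sym (+-assoc _ _ _))
  ... | no  _ = coeff-++ x y b

  coeff-⊙ : ∀ a (x : FSum) b → coeff (a ⊙ x) b ≈ a * coeff x b
  coeff-⊙ a []             b = sym (zeroʳ a)
  coeff-⊙ a ((a′ , k) ∷ x) b with k ≟ᴷ b
  ... | yes _ = trans (+-congˡ (coeff-⊙ a x b)) (sym (distribˡ _ _ _))
  ... | no  _ = coeff-⊙ a x b

  coeff-⊖ : ∀ (x y : FSum) b → coeff (x ⊖ y) b ≈ coeff x b + (- 1#) * coeff y b
  coeff-⊖ x y b = trans (coeff-++ x _ b) (+-congˡ (coeff-⊙ (- 1#) y b))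

  module Span {G : Set} (gen : G → FSum) where

    genTerm : Carrier × G → Carrier × FSum
    genTerm (a , g) = a , gen g

    span-resp : ∀ {x y} → x ≈ᶠ y → InSpan gen y → InSpan gen x
    span-resp x≈y (cs , y≈) = cs , λ b → trans (x≈y b) (y≈ b)

    span-zero : ∀ {x} → x ≈ᶠ [] → InSpan gen x
    span-zero x≈0 = [] , x≈0

    span-gen : ∀ g → InSpan gen (gen g)
    span-gen g = ((1# , g) ∷ []) , λ b → sym (begin
      coeff ((1# ⊙ gen g) ⊕ []) b  ≈⟨ coeff-++ (1# ⊙ gen g) [] b ⟩
      coeff (1# ⊙ gen g) b + 0#   ≈⟨ +-identityʳ _ ⟩
      coeff (1# ⊙ gen g) b        ≈⟨ coeff-⊙ 1# (gen g) b ⟩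
      1# * coeff (gen g) b        ≈⟨ *-identityˡ _ ⟩
      coeff (gen g) b             ∎)

    span-++ : ∀ {x y} → InSpan gen x → InSpan gen y → InSpan gen (x ⊕ y)
    span-++ {x} {y} (cs , x≈) (ds , y≈) = (cs ++ ds) , λ b → begin
      coeff (x ⊕ y) b                 ≈⟨ coeff-++ x y b ⟩
      coeff x b + coeff y b           ≈⟨ +-cong (x≈ b) (y≈ b) ⟩
      coeff (lc cs) b + coeff (lc ds) b ≈⟨ coeff-++ (lc cs) (lc ds) b ⟨
      coeff (lc cs ⊕ lc ds) b          ≡⟨ cong (λ z → coeff z b) (lc-++ cs ds) ⟨
      coeff (lc (cs ++ ds)) b          ∎
      where
      lc : List (Carrier × G) → FSum
      lc cs = lincomb (map genTerm cs)
      lc-++ : ∀ cs ds → lc (cs ++ ds) ≡ lc cs ⊕ lc ds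
      lc-++ cs ds = ≡.trans (cong lincomb (map-++ genTerm cs ds)) (concatMap-++ _ (map genTerm cs) _)

    span-⊙ : ∀ a {x} → InSpan gen x → InSpan gen (a ⊙ x)
    span-⊙ a {x} (cs , x≈) = map (λ (c′ , g) → a * c′ , g) cs , λ b →
      trans (coeff-⊙ a x b) (trans (*-congˡ (x≈ b)) (scale cs b))
      where
      scale : ∀ cs b → a * coeff (lincomb (map genTerm cs)) b
                       ≈ coeff (lincomb (map genTerm (map (λ (c′ , g) → a * c′ , g) cs))) b
      scale []             b = zeroʳ a
      scale ((c′ , g) ∷ cs) b = begin
        a * coeff ((c′ ⊙ gen g) ⊕ rest) b               ≈⟨ *-congˡ (coeff-++ (c′ ⊙ gen g) rest b) ⟩
        a * (coeff (c′ ⊙ gen g) b + coeff rest b)       ≈⟨ distribˡ _ _ _ ⟩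
        a * coeff (c′ ⊙ gen g) b + a * coeff rest b     ≈⟨ +-cong (*-congˡ (coeff-⊙ c′ (gen g) b)) (scale cs b) ⟩
        a * (c′ * coeff (gen g) b) + _                   ≈⟨ +-congʳ (sym (*-assoc _ _ _)) ⟩
        (a * c′) * coeff (gen g) b + _                   ≈⟨ +-congʳ (sym (coeff-⊙ (a * c′) (gen g) b)) ⟩
        coeff ((a * c′) ⊙ gen g) b + _                   ≈⟨ coeff-++ ((a * c′) ⊙ gen g) _ b ⟨
        _                                                ∎
        where rest = lincomb (map genTerm cs)

    quot-≈ : ∀ {x y} → x ≈ᶠ y → QuotEq gen x y
    quot-≈ {x} {y} x≈y = span-zero {x ⊖ y} λ b → begin
      coeff (x ⊖ y) b                   ≈⟨ coeff-⊖ x y b ⟩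
      coeff x b + (- 1#) * coeff y b    ≈⟨ +-congʳ (x≈y b) ⟩
      coeff y b + (- 1#) * coeff y b    ≈⟨ x-x≈0 _ ⟩
      0#                                ∎

    quot-refl : ∀ {x} → QuotEq gen x x
    quot-refl {x} = quot-≈ {x} {x} λ b → ≈-refl

    quot-≡ : ∀ {x y} → x ≡ y → QuotEq gen x y
    quot-≡ {x} refl = quot-refl {x}

    quot-sym : ∀ {x y} → QuotEq gen x y → QuotEq gen y x
    quot-sym {x} {y} x~y = span-resp {y ⊖ x} {(- 1#) ⊙ (x ⊖ y)} (λ b → begin
      coeff (y ⊖ x) b                                        ≈⟨ coeff-⊖ y x b ⟩
      coeff y b + (- 1#) * coeff x b                         ≈⟨ +-comm _ _ ⟩
      (- 1#) * coeff x b + coeff y b                         ≈⟨ +-congˡ (trans (*-congʳ -1*-1≈1) (*-identityˡ _)) ⟨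
      (- 1#) * coeff x b + ((- 1#) * (- 1#)) * coeff y b     ≈⟨ solve 3 (λ X Y m → m :* X :+ (m :* m) :* Y := m :* (X :+ m :* Y)) ≈-refl (coeff x b) (coeff y b) (- 1#) ⟩
      (- 1#) * (coeff x b + (- 1#) * coeff y b)              ≈⟨ *-congˡ (coeff-⊖ x y b) ⟨
      (- 1#) * coeff (x ⊖ y) b                               ≈⟨ coeff-⊙ (- 1#) (x ⊖ y) b ⟨
      coeff ((- 1#) ⊙ (x ⊖ y)) b                             ∎) (span-⊙ (- 1#) {x ⊖ y} x~y)

    quot-trans : ∀ {x y z} → QuotEq gen x y → QuotEq gen y z → QuotEq gen x z
    quot-trans {x} {y} {z} x~y y~z = span-resp {x ⊖ z} {(x ⊖ y) ⊕ (y ⊖ z)} (λ b → begin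
      coeff (x ⊖ z) b                                                     ≈⟨ coeff-⊖ x z b ⟩
      coeff x b + (- 1#) * coeff z b                                      ≈⟨ +-identityʳ _ ⟨
      (coeff x b + (- 1#) * coeff z b) + 0#                               ≈⟨ +-congˡ (x-x≈0 (coeff y b)) ⟨
      (coeff x b + (- 1#) * coeff z b) + (coeff y b + (- 1#) * coeff y b) ≈⟨ solve 4 (λ X Y Z m → (X :+ m :* Z) :+ (Y :+ m :* Y) := (X :+ m :* Y) :+ (Y :+ m :* Z)) ≈-refl (coeff x b) (coeff y b) (coeff z b) (- 1#) ⟩
      (coeff x b + (- 1#) * coeff y b) + (coeff y b + (- 1#) * coeff z b) ≈⟨ +-cong (coeff-⊖ x y b) (coeff-⊖ y z b) ⟨
      coeff (x ⊖ y) b + coeff (y ⊖ z) b                                   ≈⟨ coeff-++ (x ⊖ y) _ b ⟨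
      coeff ((x ⊖ y) ⊕ (y ⊖ z)) b                                         ∎) (span-++ {x ⊖ y} {y ⊖ z} x~y y~z)

    quot-++ : ∀ {x x′ y y′} → QuotEq gen x x′ → QuotEq gen y y′ → QuotEq gen (x ⊕ y) (x′ ⊕ y′)
    quot-++ {x} {x′} {y} {y′} x~x′ y~y′ = span-resp {(x ⊕ y) ⊖ (x′ ⊕ y′)} {(x ⊖ x′) ⊕ (y ⊖ y′)} (λ b → begin
      coeff ((x ⊕ y) ⊖ (x′ ⊕ y′)) b                                         ≈⟨ coeff-⊖ (x ⊕ y) _ b ⟩
      coeff (x ⊕ y) b + (- 1#) * coeff (x′ ⊕ y′) b                          ≈⟨ +-cong (coeff-++ x y b) (*-congˡ (coeff-++ x′ y′ b)) ⟩
      (coeff x b + coeff y b) + (- 1#) * (coeff x′ b + coeff y′ b)          ≈⟨ solve 5 (λ X Y X′ Y′ m → (X :+ Y) :+ m :* (X′ :+ Y′) := (X :+ m :* X′) :+ (Y :+ m :* Y′)) ≈-refl (coeff x b) (coeff y b) (coeff x′ b) (coeff y′ b) (- 1#) ⟩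
      (coeff x b + (- 1#) * coeff x′ b) + (coeff y b + (- 1#) * coeff y′ b) ≈⟨ +-cong (coeff-⊖ x x′ b) (coeff-⊖ y y′ b) ⟨
      coeff (x ⊖ x′) b + coeff (y ⊖ y′) b                                   ≈⟨ coeff-++ (x ⊖ x′) _ b ⟨
      coeff ((x ⊖ x′) ⊕ (y ⊖ y′)) b                                         ∎) (span-++ {x ⊖ x′} {y ⊖ y′} x~x′ y~y′)

    quot-⊙ : ∀ a {x y} → QuotEq gen x y → QuotEq gen (a ⊙ x) (a ⊙ y)
    quot-⊙ a {x} {y} x~y = span-resp {(a ⊙ x) ⊖ (a ⊙ y)} {a ⊙ (x ⊖ y)} (λ b → begin
      coeff ((a ⊙ x) ⊖ (a ⊙ y)) b                 ≈⟨ coeff-⊖ (a ⊙ x) _ b ⟩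
      coeff (a ⊙ x) b + (- 1#) * coeff (a ⊙ y) b  ≈⟨ +-cong (coeff-⊙ a x b) (*-congˡ (coeff-⊙ a y b)) ⟩
      a * coeff x b + (- 1#) * (a * coeff y b)    ≈⟨ solve 4 (λ A X Y m → A :* X :+ m :* (A :* Y) := A :* (X :+ m :* Y)) ≈-refl a (coeff x b) (coeff y b) (- 1#) ⟩
      a * (coeff x b + (- 1#) * coeff y b)        ≈⟨ *-congˡ (coeff-⊖ x y b) ⟨
      a * coeff (x ⊖ y) b                         ≈⟨ coeff-⊙ a (x ⊖ y) b ⟨
      coeff (a ⊙ (x ⊖ y)) b                       ∎) (span-⊙ a {x ⊖ y} x~y)

  -- Evaluation only
  -- depends on the coefficients (evaluate-cong); this is what makes linear
  -- extensions of maps respect coefficientwise equality.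
  evaluate : (K → Carrier) → FSum → Carrier
  evaluate h []            = 0#
  evaluate h ((a , k) ∷ z) = a * h k + evaluate h z

  evaluate-++ : ∀ h x y → evaluate h (x ⊕ y) ≈ evaluate h x + evaluate h y
  evaluate-++ h []            y = sym (+-identityˡ _)
  evaluate-++ h ((a , k) ∷ x) y = trans (+-congˡ (evaluate-++ h x y)) (sym (+-assoc _ _ _))

  evaluate-⊙ : ∀ h a x → evaluate h (a ⊙ x) ≈ a * evaluate h x
  evaluate-⊙ h a []             = sym (zeroʳ _)
  evaluate-⊙ h a ((a′ , k) ∷ x) = trans (+-cong (*-assoc _ _ _) (evaluate-⊙ h a x)) (sym (distribˡ _ _ _))

  onKey offKey : K → FSum → FSum
  onKey k []            = []
  onKey k ((a , x) ∷ z) with x ≟ᴷ k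
  ... | yes _ = (a , x) ∷ onKey k z
  ... | no  _ = onKey k z
  offKey k []            = []
  offKey k ((a , x) ∷ z) with x ≟ᴷ k
  ... | yes _ = offKey k z
  ... | no  _ = (a , x) ∷ offKey k z

  evaluate-split : ∀ h k z → evaluate h z ≈ evaluate h (onKey k z) + evaluate h (offKey k z)
  evaluate-split h k []            = sym (+-identityʳ _)
  evaluate-split h k ((a , x) ∷ z) with x ≟ᴷ k
  ... | yes _ = trans (+-congˡ (evaluate-split h k z)) (sym (+-assoc _ _ _))
  ... | no  _ = trans (+-congˡ (evaluate-split h k z))
                      (solve 3 (λ A B C → A :+ (B :+ C) := B :+ (A :+ C)) ≈-refl (a * h x) (evaluate h (onKey k z)) (evaluate h (offKey k z)))

  coeff-split : ∀ k z b → coeff z b ≈ coeff (onKey k z) b + coeff (offKey k z) b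
  coeff-split k []            b = sym (+-identityʳ _)
  coeff-split k ((a , x) ∷ z) b with x ≟ᴷ k
  coeff-split k ((a , x) ∷ z) b | yes _ with x ≟ᴷ b
  ... | yes _ = trans (+-congˡ (coeff-split k z b)) (sym (+-assoc _ _ _))
  ... | no  _ = coeff-split k z b
  coeff-split k ((a , x) ∷ z) b | no _ with x ≟ᴷ b
  ... | yes _ = trans (+-congˡ (coeff-split k z b))
                      (solve 3 (λ A B C → A :+ (B :+ C) := B :+ (A :+ C)) ≈-refl a (coeff (onKey k z) b) (coeff (offKey k z) b))
  ... | no  _ = coeff-split k z b

  evaluate-onKey : ∀ h k z → evaluate h (onKey k z) ≈ coeff (onKey k z) k * h k
  evaluate-onKey h k []            = sym (zeroˡ _)
  evaluate-onKey h k ((a , x) ∷ z) with x ≟ᴷ k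
  ... | no  _    = evaluate-onKey h k z
  ... | yes refl with x ≟ᴷ x
  ...   | no x≢x = ⊥-elim (x≢x refl)
  ...   | yes _  = trans (+-congˡ (evaluate-onKey h x z)) (sym (distribʳ _ _ _))

  coeff-offKey : ∀ k z → coeff (offKey k z) k ≈ 0#
  coeff-offKey k []            = ≈-refl
  coeff-offKey k ((a , x) ∷ z) with x ≟ᴷ k
  ... | yes _  = coeff-offKey k z
  ... | no x≢k with x ≟ᴷ k
  ...   | yes x≡k = ⊥-elim (x≢k x≡k)
  ...   | no  _   = coeff-offKey k z

  coeff-onKey : ∀ k z b → b ≢ k → coeff (onKey k z) b ≈ 0#
  coeff-onKey k []            b b≢k = ≈-refl
  coeff-onKey k ((a , x) ∷ z) b b≢k with x ≟ᴷ k
  ... | no  _    = coeff-onKey k z b b≢k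
  ... | yes refl with x ≟ᴷ b
  ...   | yes x≡b = ⊥-elim (b≢k (≡.sym x≡b))
  ...   | no  _   = coeff-onKey x z b b≢k

  length-offKey : ∀ k z → length (offKey k z) ≤ length z
  length-offKey k []            = z≤n
  length-offKey k ((a , x) ∷ z) with x ≟ᴷ k
  ... | yes _ = m≤n⇒m≤1+n (length-offKey k z)
  ... | no  _ = s≤s (length-offKey k z)

  δᵏ-self : ∀ k → δᵏ k k ≈ 1#
  δᵏ-self k with k ≟ᴷ k
  ... | yes _  = +-identityʳ 1#
  ... | no k≢k = ⊥-elim (k≢k refl)

  δᵏ-other : ∀ {k b} → b ≢ k → δᵏ k b ≈ 0#
  δᵏ-other {k} {b} b≢k with k ≟ᴷ b
  ... | yes k≡b = ⊥-elim (b≢k (≡.sym k≡b))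
  ... | no  _   = ≈-refl

  module _ {a k z} (vanish : ∀ b → coeff ((a , k) ∷ z) b ≈ 0#) where

    offKey-vanishes : ∀ b → coeff (offKey k z) b ≈ 0#
    offKey-vanishes b with b ≟ᴷ k
    ... | yes refl = coeff-offKey b z
    ... | no b≢k   = begin
      coeff (offKey k z) b                         ≈⟨ +-identityˡ _ ⟨
      0# + coeff (offKey k z) b                    ≈⟨ +-congʳ (coeff-onKey k z b b≢k) ⟨
      coeff (onKey k z) b + coeff (offKey k z) b   ≈⟨ coeff-split k z b ⟨
      coeff z b                                    ≈⟨ +-identityˡ _ ⟨
      0# + coeff z b                               ≈⟨ +-congʳ (trans (*-congˡ (δᵏ-other b≢k)) (zeroʳ a)) ⟨
      a * δᵏ k b + coeff z b                       ≈⟨ coeff-∷ a k z b ⟨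
      coeff ((a , k) ∷ z) b                        ≈⟨ vanish b ⟩
      0#                                           ∎

    onKey-cancels : a + coeff (onKey k z) k ≈ 0#
    onKey-cancels = begin
      a + coeff (onKey k z) k                            ≈⟨ +-congˡ (trans (+-congˡ (coeff-offKey k z)) (+-identityʳ _)) ⟨
      a + (coeff (onKey k z) k + coeff (offKey k z) k)   ≈⟨ +-congˡ (coeff-split k z k) ⟨
      a + coeff z k                                      ≈⟨ +-congʳ (trans (*-congˡ (δᵏ-self k)) (*-identityʳ a)) ⟨
      a * δᵏ k k + coeff z k                             ≈⟨ coeff-∷ a k z k ⟨
      coeff ((a , k) ∷ z) k                              ≈⟨ vanish k ⟩
      0#                                                 ∎

  -- A formal sum all of whose coefficients vanish evaluates to 0: the terms
  -- with the key of the first term cancel, and the strictly shorter rest is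
  -- handled by recursion.
  evaluate-zero : ∀ h n z → length z ≤ n → (∀ b → coeff z b ≈ 0#) → evaluate h z ≈ 0#
  evaluate-zero h n       []            _         _      = ≈-refl
  evaluate-zero h (suc n) ((a , k) ∷ z) (s≤s len) vanish = begin
    a * h k + evaluate h z                                            ≈⟨ +-congˡ (evaluate-split h k z) ⟩
    a * h k + (evaluate h (onKey k z) + evaluate h (offKey k z))      ≈⟨ +-congˡ (+-cong (evaluate-onKey h k z) rest≈0) ⟩
    a * h k + (coeff (onKey k z) k * h k + 0#)                        ≈⟨ +-congˡ (+-identityʳ _) ⟩
    a * h k + coeff (onKey k z) k * h k                               ≈⟨ distribʳ _ _ _ ⟨
    (a + coeff (onKey k z) k) * h k                                   ≈⟨ *-congʳ (onKey-cancels vanish) ⟩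
    0# * h k                                                          ≈⟨ zeroˡ _ ⟩
    0#                                                                ∎
    where
    rest≈0 : evaluate h (offKey k z) ≈ 0#
    rest≈0 = evaluate-zero h n (offKey k z) (≤-trans (length-offKey k z) len) (offKey-vanishes vanish)

  evaluate-cong : ∀ h {x y} → x ≈ᶠ y → evaluate h x ≈ evaluate h y
  evaluate-cong h {x} {y} x≈y = begin
    evaluate h x                                                   ≈⟨ +-identityʳ _ ⟨
    evaluate h x + 0#                                              ≈⟨ +-congˡ (trans (+-comm _ _) (x-x≈0 (evaluate h y))) ⟨
    evaluate h x + ((- 1#) * evaluate h y + evaluate h y)          ≈⟨ +-assoc _ _ _ ⟨
    (evaluate h x + (- 1#) * evaluate h y) + evaluate h y          ≈⟨ +-congʳ (+-congˡ (evaluate-⊙ h (- 1#) y)) ⟨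
    (evaluate h x + evaluate h ((- 1#) ⊙ y)) + evaluate h y        ≈⟨ +-congʳ (evaluate-++ h x _) ⟨
    evaluate h (x ⊖ y) + evaluate h y                              ≈⟨ +-congʳ (evaluate-zero h _ (x ⊖ y) ≤-refl difference≈0) ⟩
    0# + evaluate h y                                              ≈⟨ +-identityˡ _ ⟩
    evaluate h y                                                   ∎
    where
    difference≈0 : ∀ b → coeff (x ⊖ y) b ≈ 0#
    difference≈0 b = trans (coeff-⊖ x y b) (trans (+-congʳ (x≈y b)) (x-x≈0 _))

module LinearExtension {c ℓ} (F : Field c ℓ)
    (K₁ : Set) (_≟₁_ : DecidableEquality K₁) (K₂ : Set) (_≟₂_ : DecidableEquality K₂)
    (f : K₁ → FreeModule.FSum F K₂ _≟₂_) where
  open Field F renaming (refl to ≈-refl)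
  open import Relation.Binary.Reasoning.Setoid setoid
  private
    module M₁ = FreeModule F K₁ _≟₁_
    module M₂ = FreeModule F K₂ _≟₂_
    module S₁ = FormalSums F K₁ _≟₁_
    module S₂ = FormalSums F K₂ _≟₂_

  extend : M₁.FSum → M₂.FSum
  extend = concatMap (λ p → proj₁ p M₂.⊙ f (proj₂ p))

  extend-++ : ∀ x y → extend (x M₁.⊕ y) ≡ extend x M₂.⊕ extend y
  extend-++ = concatMap-++ (λ p → proj₁ p M₂.⊙ f (proj₂ p))

  coeff-extend : ∀ x b → M₂.coeff (extend x) b ≈ S₁.evaluate (λ k → M₂.coeff (f k) b) x
  coeff-extend []            b = ≈-refl
  coeff-extend ((a , k) ∷ x) b = trans (S₂.coeff-++ (a M₂.⊙ f k) (extend x) b) (+-cong (S₂.coeff-⊙ a (f k) b) (coeff-extend x b))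

  extend-single : ∀ k → extend ((1# , k) ∷ []) M₂.≈ᶠ f k
  extend-single k b = trans (coeff-extend ((1# , k) ∷ []) b) (trans (+-identityʳ _) (*-identityˡ _))

  extend-cong : ∀ {x y} → x M₁.≈ᶠ y → extend x M₂.≈ᶠ extend y
  extend-cong {x} {y} x≈y b =
    trans (coeff-extend x b) (trans (S₁.evaluate-cong (λ k → M₂.coeff (f k) b) {x} {y} x≈y) (sym (coeff-extend y b)))

  extend-⊙ : ∀ a x → extend (a M₁.⊙ x) M₂.≈ᶠ (a M₂.⊙ extend x)
  extend-⊙ a x b = begin
    M₂.coeff (extend (a M₁.⊙ x)) b                    ≈⟨ coeff-extend (a M₁.⊙ x) b ⟩
    S₁.evaluate (λ k → M₂.coeff (f k) b) (a M₁.⊙ x)   ≈⟨ S₁.evaluate-⊙ _ a x ⟩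
    a * S₁.evaluate (λ k → M₂.coeff (f k) b) x        ≈⟨ *-congˡ (coeff-extend x b) ⟨
    a * M₂.coeff (extend x) b                         ≈⟨ S₂.coeff-⊙ a (extend x) b ⟨
    M₂.coeff (a M₂.⊙ extend x) b                      ∎

  module _ {G₁ G₂ : Set} (gen₁ : G₁ → M₁.FSum) (gen₂ : G₂ → M₂.FSum)
           (gen-to-span : ∀ g → M₂.InSpan gen₂ (extend (gen₁ g))) where
    private
      module Sp₁ = S₁.Span gen₁
      module Sp₂ = S₂.Span gen₂

    extend-lincomb : ∀ cs → M₂.InSpan gen₂ (extend (M₁.lincomb (map Sp₁.genTerm cs)))
    extend-lincomb []             = Sp₂.span-zero {[]} (λ b → ≈-refl)
    extend-lincomb ((a , g) ∷ cs) =
      subst (M₂.InSpan gen₂) (≡.sym (extend-++ (a M₁.⊙ gen₁ g) _))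
        (Sp₂.span-++ {extend (a M₁.⊙ gen₁ g)}
          (Sp₂.span-resp {extend (a M₁.⊙ gen₁ g)} {a M₂.⊙ extend (gen₁ g)} (extend-⊙ a (gen₁ g)) (Sp₂.span-⊙ a {extend (gen₁ g)} (gen-to-span g)))
          (extend-lincomb cs))

    extend-quot : ∀ {x y} → M₁.QuotEq gen₁ x y → M₂.QuotEq gen₂ (extend x) (extend y)
    extend-quot {x} {y} (cs , x-y≈) = Sp₂.span-resp {extend x M₂.⊖ extend y} {extend (M₁.lincomb (map Sp₁.genTerm cs))}
      (λ b → begin
        M₂.coeff (extend x M₂.⊖ extend y) b                           ≈⟨ S₂.coeff-⊖ (extend x) (extend y) b ⟩
        M₂.coeff (extend x) b + (- 1#) * M₂.coeff (extend y) b        ≈⟨ +-congˡ (trans (extend-⊙ (- 1#) y b) (S₂.coeff-⊙ (- 1#) (extend y) b)) ⟨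
        M₂.coeff (extend x) b + M₂.coeff (extend ((- 1#) M₁.⊙ y)) b   ≈⟨ S₂.coeff-++ (extend x) _ b ⟨
        M₂.coeff (extend x M₂.⊕ extend ((- 1#) M₁.⊙ y)) b             ≡⟨ cong (λ z → M₂.coeff z b) (extend-++ x _) ⟨
        M₂.coeff (extend (x M₁.⊖ y)) b                                ≈⟨ extend-cong {x M₁.⊖ y} {M₁.lincomb (map Sp₁.genTerm cs)} x-y≈ b ⟩
        M₂.coeff (extend (M₁.lincomb (map Sp₁.genTerm cs))) b         ∎)
      (extend-lincomb cs)

module _ {s : ℕ} where
  open import Data.Fin.Permutation using (Permutation′; _⟨$⟩ʳ_; _⟨$⟩ˡ_; inverseˡ; inverseʳ; flip)

  actF-valid : ∀ (σ : Permutation′ s) λs t → ValidFilling λs t → ValidFilling λs (actF σ t)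
  actF-valid σ λs t (shape , u , cover) =
    ≡.trans (≡.sym (map-∘ t)) (≡.trans (map-cong (λ r → length-map (σ ⟨$⟩ʳ_) r) t) shape) ,
    subst Unique (≡.sym (concat-map t)) (Unique.map⁺ σ-injective u) ,
    λ k → subst (k ∈_) (≡.sym (concat-map t))
            (subst (_∈ map (σ ⟨$⟩ʳ_) (concat t)) (inverseʳ σ) (∈-map⁺ (σ ⟨$⟩ʳ_) (cover (σ ⟨$⟩ˡ k))))
    where
    σ-injective : ∀ {x y} → σ ⟨$⟩ʳ x ≡ σ ⟨$⟩ʳ y → x ≡ y
    σ-injective {x} {y} e = ≡.trans (≡.sym (inverseˡ σ)) (≡.trans (cong (σ ⟨$⟩ˡ_) e) (inverseˡ σ))

  actF-inverse : ∀ (σ : Permutation′ s) t → actF (flip σ) (actF σ t) ≡ t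
  actF-inverse σ t = ≡.trans (≡.sym (map-∘ t))
    (≡.trans (map-cong (λ r → ≡.trans (≡.sym (map-∘ r)) (≡.trans (map-cong (λ _ → inverseˡ σ) r) (map-id r))) t) (map-id t))

  actF-valid⁻ : ∀ (σ : Permutation′ s) λs t → ValidFilling λs (actF σ t) → ValidFilling λs t
  actF-valid⁻ σ λs t v = subst (ValidFilling λs) (actF-inverse σ t) (actF-valid (flip σ) λs (actF σ t) v)

  -- validity of a filling is decidable, so φ and ψ can treat non-fillings as 0
  valid? : ∀ λs (t : Filling s) → Dec (ValidFilling λs t)
  valid? λs t = ≡-dec ℕ._≟_ (map length t) λs
                ×-dec UniqueDec.unique? _≟_ (concat t)
                ×-dec all? (λ k → DecMembership._∈?_ _≟_ k (concat t))

-- Rows of a filling by index: nthRow t k is the k-th row of t, and [] past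
-- the end.
nthRow : List (List A) → ℕ → List A
nthRow []      k       = []
nthRow (r ∷ t) zero    = r
nthRow (r ∷ t) (suc k) = nthRow t k

rowAt : ∀ {d} → List (List A) → Fin d → List A
rowAt t i = nthRow t (Fin.toℕ i)

nthRow-∈ : ∀ (t : List (List A)) k → nthRow t k ∈ t ⊎ nthRow t k ≡ []
nthRow-∈ []      k       = inj₂ refl
nthRow-∈ (r ∷ t) zero    = inj₁ (here refl)
nthRow-∈ (r ∷ t) (suc k) = [ (λ r∈ → inj₁ (there r∈)) , inj₂ ]′ (nthRow-∈ t k)

nthRow-map : ∀ (h : List A → List A) → h [] ≡ [] → ∀ t k → nthRow (map h t) k ≡ h (nthRow t k)
nthRow-map h h[] []      k       = ≡.sym h[]
nthRow-map h h[] (r ∷ t) zero    = refl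
nthRow-map h h[] (r ∷ t) (suc k) = nthRow-map h h[] t k

rowAt-tabulate : ∀ {d} (f : B → List A) (g : Fin d → B) i → rowAt (map f (tabulate g)) i ≡ f (g i)
rowAt-tabulate f g Fin.zero    = refl
rowAt-tabulate f g (Fin.suc i) = rowAt-tabulate f (λ i → g (Fin.suc i)) i

unique-concat-row : ∀ {t : List (List A)} {r} → Unique (concat t) → r ∈ t → Unique r
unique-concat-row {t = t} u = unique-concatMap-piece (λ r → r) (subst Unique (cong concat (≡.sym (map-id t))) u)

unique-concat-disjoint : ∀ {t : List (List A)} {r r′ k} → Unique (concat t) → r ∈ t → r′ ∈ t → k ∈ r → k ∈ r′ → r ≡ r′
unique-concat-disjoint {t = t} u = unique-concatMap-disjoint (λ r → r) (subst Unique (cong concat (≡.sym (map-id t))) u)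

module SwapInRow {m} (t : List (List (Fin m))) (u : Unique (concat t)) (a b : Fin m) (a≢b : a ≢ b) (row : SameRow t a b) where
  open Transposition a b a≢b
  open import Data.Fin.Permutation using (transpose)

  private
    found = find row
    r₀ = proj₁ found
    r₀∈ = proj₁ (proj₂ found)
    a∈r₀ = proj₁ (proj₂ (proj₂ found))
    b∈r₀ = proj₂ (proj₂ (proj₂ found))

  a∈⇔b∈ : ∀ r → r ∈ t ⊎ r ≡ [] → (a ∈ r → b ∈ r) × (b ∈ r → a ∈ r)
  a∈⇔b∈ r (inj₁ r∈)  = (λ a∈ → subst (b ∈_) (≡.sym (unique-concat-disjoint u r∈ r₀∈ a∈ a∈r₀)) b∈r₀) ,
                       (λ b∈ → subst (a ∈_) (≡.sym (unique-concat-disjoint u r∈ r₀∈ b∈ b∈r₀)) a∈r₀)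
  a∈⇔b∈ r (inj₂ refl) = (λ ()) , (λ ())

  τ-row-set : ∀ r → (a ∈ r → b ∈ r) → (b ∈ r → a ∈ r) → fromList (map τ r) ≡ fromList r
  τ-row-set r a→b b→a = fromList-ext (λ z∈ → let (w , w∈ , z≡) = ∈-map⁻ τ z∈ in subst (_∈ r) (≡.sym z≡) (τ-stays w∈))
                                     (λ {z} z∈ → subst (_∈ map τ r) (τ-involutive z) (∈-map⁺ τ (τ-stays z∈)))
    where
    τ-stays : ∀ {w} → w ∈ r → τ w ∈ r
    τ-stays {w} w∈ = by-cases (w ≟ a) (w ≟ b)
      where
      by-cases : Dec (w ≡ a) → Dec (w ≡ b) → τ w ∈ r
      by-cases (yes refl) _          = subst (_∈ r) (≡.sym τa) (a→b w∈)
      by-cases (no _)     (yes refl) = subst (_∈ r) (≡.sym τb) (b→a w∈)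
      by-cases (no w≢a)   (no w≢b)   = subst (_∈ r) (≡.sym (τ-fixed w≢a w≢b)) w∈

  rowAt-swap : ∀ {d} (i : Fin d) → fromList (rowAt (actF (transpose a b) t) i) ≡ fromList (rowAt t i)
  rowAt-swap i = ≡.trans (cong fromList (nthRow-map (map τ) refl t (Fin.toℕ i)))
    (let r = rowAt t i ; (a→b , b→a) = a∈⇔b∈ r (nthRow-∈ t (Fin.toℕ i)) in τ-row-set r a→b b→a)

  inversionParity-swap : inversionParity (concat (actF (transpose a b) t)) ≡ not (inversionParity (concat t))
  inversionParity-swap = ≡.trans (cong inversionParity (concat-map t))
    (inversionParity-τ u (∈-concat⁺′ a∈r₀ r₀∈) (∈-concat⁺′ b∈r₀ r₀∈))

Tag : ℕ → Set
Tag d = Fin d × Fin d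

_≟ᵀ_ : ∀ {d} → DecidableEquality (Tag d)
_≟ᵀ_ = ×-≡-dec _≟_ _≟_

rowMajor colMajor : ∀ d → List (Tag d)
rowMajor d = concatMap (λ i → map (λ j → (i , j)) (allFin d)) (allFin d)
colMajor d = concatMap (λ j → map (λ i → (i , j)) (allFin d)) (allFin d)

∈-rowMajor : ∀ {d} (p : Tag d) → p ∈ rowMajor d
∈-rowMajor {d} (i , j) = ∈-concatMap-intro (λ i → map (λ j → (i , j)) (allFin d)) (∈-allFin i) (∈-map⁺ (λ j → (i , j)) (∈-allFin j))

∈-colMajor : ∀ {d} (p : Tag d) → p ∈ colMajor d
∈-colMajor {d} (i , j) = ∈-concatMap-intro (λ j → map (λ i → (i , j)) (allFin d)) (∈-allFin j) (∈-map⁺ (λ i → (i , j)) (∈-allFin i))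

unique-rowMajor : ∀ d → Unique (rowMajor d)
unique-rowMajor d = unique-concatMap⁺ _ (Unique.allFin⁺ d)
  (λ _ → Unique.map⁺ (λ e → proj₂ (,-injective e)) (Unique.allFin⁺ d))
  λ _ _ p∈ p∈′ → let (_ , _ , e) = ∈-map⁻ _ p∈ ; (_ , _ , e′) = ∈-map⁻ _ p∈′ in ≡.trans (≡.sym (cong proj₁ e)) (cong proj₁ e′)

unique-colMajor : ∀ d → Unique (colMajor d)
unique-colMajor d = unique-concatMap⁺ _ (Unique.allFin⁺ d)
  (λ _ → Unique.map⁺ (λ e → proj₁ (,-injective e)) (Unique.allFin⁺ d))
  λ _ _ p∈ p∈′ → let (_ , _ , e) = ∈-map⁻ _ p∈ ; (_ , _ , e′) = ∈-map⁻ _ p∈′ in ≡.trans (≡.sym (cong proj₂ e)) (cong proj₂ e′)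

concat-rows : ∀ {d} (M : Fin d → Fin d → List A) →
  concat (map (λ i → concatMap (M i) (allFin d)) (allFin d)) ≡ concatMap (λ p → M (proj₁ p) (proj₂ p)) (rowMajor d)
concat-rows {d = d} M = ≡.sym (flatten (allFin d))
  where
  flatten : ∀ is → concatMap (λ p → M (proj₁ p) (proj₂ p)) (concatMap (λ i → map (λ j → (i , j)) (allFin d)) is)
                   ≡ concatMap (λ i → concatMap (M i) (allFin d)) is
  flatten []       = refl
  flatten (i ∷ is) = ≡.trans (concatMap-++ _ (map (λ j → (i , j)) (allFin d)) _)
                             (cong₂ _++_ (concatMap-map _ _ (allFin d)) (flatten is))

concat-columns : ∀ {d} (M : Fin d → Fin d → List A) →
  concat (map (λ j → concatMap (λ i → M i j) (allFin d)) (allFin d)) ≡ concatMap (λ p → M (proj₁ p) (proj₂ p)) (colMajor d)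
concat-columns {d = d} M = ≡.sym (flatten (allFin d))
  where
  flatten : ∀ js → concatMap (λ p → M (proj₁ p) (proj₂ p)) (concatMap (λ j → map (λ i → (i , j)) (allFin d)) js)
                   ≡ concatMap (λ j → concatMap (λ i → M i j) (allFin d)) js
  flatten []       = refl
  flatten (j ∷ js) = ≡.trans (concatMap-++ _ (map (λ i → (i , j)) (allFin d)) _)
                             (cong₂ _++_ (concatMap-map _ _ (allFin d)) (flatten js))

insertTagged : A × ℕ → List (A × ℕ) → List (A × ℕ)
insertTagged x []       = x ∷ []
insertTagged x (y ∷ ys) = if proj₂ y ≤ᵇ proj₂ x then x ∷ y ∷ ys else y ∷ insertTagged x ys

sortTagged : List (A × ℕ) → List (A × ℕ)
sortTagged []       = []
sortTagged (x ∷ xs) = insertTagged x (sortTagged xs)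

dropZeroTagged : List (A × ℕ) → List (A × ℕ)
dropZeroTagged []                = []
dropZeroTagged ((a , zero)  ∷ xs) = dropZeroTagged xs
dropZeroTagged ((a , suc k) ∷ xs) = (a , suc k) ∷ dropZeroTagged xs

insertTagged-sizes : ∀ (x : A × ℕ) ys → map proj₂ (insertTagged x ys) ≡ insertDesc (proj₂ x) (map proj₂ ys)
insertTagged-sizes x []       = refl
insertTagged-sizes x (y ∷ ys) with proj₂ y ≤ᵇ proj₂ x
... | true  = refl
... | false = cong (proj₂ y ∷_) (insertTagged-sizes x ys)

sortTagged-sizes : ∀ (xs : List (A × ℕ)) → map proj₂ (sortTagged xs) ≡ sortDesc (map proj₂ xs)
sortTagged-sizes []       = refl
sortTagged-sizes (x ∷ xs) = ≡.trans (insertTagged-sizes x (sortTagged xs)) (cong (insertDesc (proj₂ x)) (sortTagged-sizes xs))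

dropZeroTagged-sizes : ∀ (xs : List (A × ℕ)) → map proj₂ (dropZeroTagged xs) ≡ dropZeros (map proj₂ xs)
dropZeroTagged-sizes []                = refl
dropZeroTagged-sizes ((a , zero)  ∷ xs) = dropZeroTagged-sizes xs
dropZeroTagged-sizes ((a , suc k) ∷ xs) = cong (suc k ∷_) (dropZeroTagged-sizes xs)

insertTagged-↭ : ∀ (x : A × ℕ) ys → insertTagged x ys ↭ x ∷ ys
insertTagged-↭ x []       = ↭-refl
insertTagged-↭ x (y ∷ ys) with proj₂ y ≤ᵇ proj₂ x
... | true  = ↭-refl
... | false = ↭-trans (↭-prep y (insertTagged-↭ x ys)) (↭.swap y x ↭-refl)

sortTagged-↭ : ∀ (xs : List (A × ℕ)) → sortTagged xs ↭ xs
sortTagged-↭ []       = ↭-refl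
sortTagged-↭ (x ∷ xs) = ↭-trans (insertTagged-↭ x (sortTagged xs)) (↭-prep x (sortTagged-↭ xs))

dropZeroTagged-∈⁻ : ∀ {c : A × ℕ} xs → c ∈ dropZeroTagged xs → c ∈ xs
dropZeroTagged-∈⁻ ((a , zero)  ∷ xs) c∈         = there (dropZeroTagged-∈⁻ xs c∈)
dropZeroTagged-∈⁻ ((a , suc k) ∷ xs) (here e)   = here e
dropZeroTagged-∈⁻ ((a , suc k) ∷ xs) (there c∈) = there (dropZeroTagged-∈⁻ xs c∈)

dropZeroTagged-∈⁺ : ∀ {c : A × ℕ} xs → c ∈ xs → proj₂ c ≢ 0 → c ∈ dropZeroTagged xs
dropZeroTagged-∈⁺ ((a , zero)  ∷ xs) (here refl) c≢0 = ⊥-elim (c≢0 refl)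
dropZeroTagged-∈⁺ ((a , zero)  ∷ xs) (there c∈) c≢0  = dropZeroTagged-∈⁺ xs c∈ c≢0
dropZeroTagged-∈⁺ ((a , suc k) ∷ xs) (here e)   c≢0  = here e
dropZeroTagged-∈⁺ ((a , suc k) ∷ xs) (there c∈) c≢0  = there (dropZeroTagged-∈⁺ xs c∈ c≢0)

dropZeroTagged-unique : ∀ (xs : List (A × ℕ)) → Unique (map proj₁ xs) → Unique (map proj₁ (dropZeroTagged xs))
dropZeroTagged-unique []                u          = u
dropZeroTagged-unique ((a , zero)  ∷ xs) (_ ∷ u)    = dropZeroTagged-unique xs u
dropZeroTagged-unique ((a , suc k) ∷ xs) (a∉ ∷ u) =
  All.tabulate (λ b∈ e → let (c , c∈ , b≡) = ∈-map⁻ proj₁ b∈ in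
    All.lookup a∉ (∈-map⁺ proj₁ (dropZeroTagged-∈⁻ xs c∈)) (≡.trans e b≡))
  ∷ dropZeroTagged-unique xs u

-- Attaching the rows of a filling to tags: given tagged sizes Z and a list of
-- rows t, rowAtTag Z t q is the row of t standing at the position of q in Z
-- (and [] if q does not occur).
module RowAtTag {T X : Set} (_≟ᵗ_ : DecidableEquality T) where

  rowAtTag : List (T × ℕ) → List (List X) → T → List X
  rowAtTag []      t       q = []
  rowAtTag (c ∷ Z) []      q = []
  rowAtTag (c ∷ Z) (r ∷ t) q with proj₁ c ≟ᵗ q
  ... | yes _ = r
  ... | no  _ = rowAtTag Z t q

  rowAtTag-absent : ∀ Z (t : List (List X)) q → q ∉ map proj₁ Z → rowAtTag Z t q ≡ []
  rowAtTag-absent []      t       q q∉ = refl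
  rowAtTag-absent (c ∷ Z) []      q q∉ = refl
  rowAtTag-absent (c ∷ Z) (r ∷ t) q q∉ with proj₁ c ≟ᵗ q
  ... | yes e = ⊥-elim (q∉ (here (≡.sym e)))
  ... | no  _ = rowAtTag-absent Z t q (λ q∈ → q∉ (there q∈))

  rowAtTag-length : ∀ (size : T → ℕ) Z (t : List (List X)) → map length t ≡ map proj₂ Z →
                    (∀ {c} → c ∈ Z → proj₂ c ≡ size (proj₁ c)) → ∀ q → q ∈ map proj₁ Z → length (rowAtTag Z t q) ≡ size q
  rowAtTag-length size (c ∷ Z) (r ∷ t) lengths sizes q q∈ with proj₁ c ≟ᵗ q | q∈
  ... | yes refl | _          = ≡.trans (proj₁ (∷-injective lengths)) (sizes (here refl))
  ... | no c≢q   | here q≡c   = ⊥-elim (c≢q (≡.sym q≡c))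
  ... | no _     | there q∈′  = rowAtTag-length size Z t (proj₂ (∷-injective lengths)) (λ c∈ → sizes (there c∈)) q q∈′

  rowAtTag-all : ∀ Z (t : List (List X)) → Unique (map proj₁ Z) → length t ≡ length Z →
                 map (λ c → rowAtTag Z t (proj₁ c)) Z ≡ t
  rowAtTag-all []      []      _          _ = refl
  rowAtTag-all (c ∷ Z) (r ∷ t) (c∉ ∷ u) len with proj₁ c ≟ᵗ proj₁ c
  ... | no c≢c = ⊥-elim (c≢c refl)
  ... | yes _  = cong (r ∷_) (≡.trans (map-cong-local (All.tabulate skip)) (rowAtTag-all Z t u (cong ℕ.pred len)))
    where
    skip : ∀ {c′} → c′ ∈ Z → rowAtTag (c ∷ Z) (r ∷ t) (proj₁ c′) ≡ rowAtTag Z t (proj₁ c′)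
    skip {c′} c′∈ with proj₁ c ≟ᵗ proj₁ c′
    ... | yes e = ⊥-elim (All.lookup c∉ (∈-map⁺ proj₁ c′∈) e)
    ... | no  _ = refl

  rowAtTag-tabulate : ∀ Z (g : T → List X) q → Unique (map proj₁ Z) → q ∈ map proj₁ Z →
                      rowAtTag Z (map (λ c → g (proj₁ c)) Z) q ≡ g q
  rowAtTag-tabulate (c ∷ Z) g q (_ ∷ u) q∈ with proj₁ c ≟ᵗ q | q∈
  ... | yes e    | _         = cong g e
  ... | no c≢q   | here q≡c  = ⊥-elim (c≢q (≡.sym q≡c))
  ... | no _     | there q∈′ = rowAtTag-tabulate Z g q u q∈′

  rowAtTag-map : ∀ (h : List X → List X) → h [] ≡ [] → ∀ Z t q → rowAtTag Z (map h t) q ≡ h (rowAtTag Z t q)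
  rowAtTag-map h h[] []      t       q = ≡.sym h[]
  rowAtTag-map h h[] (c ∷ Z) []      q = ≡.sym h[]
  rowAtTag-map h h[] (c ∷ Z) (r ∷ t) q with proj₁ c ≟ᵗ q
  ... | yes _ = refl
  ... | no  _ = rowAtTag-map h h[] Z t q

  rowAtTag-pointwise : ∀ {R : List X → List X → Set} → R [] [] → ∀ Z {t t′} → Pointwise R t t′ →
                       ∀ q → R (rowAtTag Z t q) (rowAtTag Z t′ q)
  rowAtTag-pointwise R[] []      _        q = R[]
  rowAtTag-pointwise R[] (c ∷ Z) []       q = R[]
  rowAtTag-pointwise R[] (c ∷ Z) (r ∷ rs) q with proj₁ c ≟ᵗ q
  ... | yes _ = r
  ... | no  _ = rowAtTag-pointwise R[] Z rs q

-- The nonzero cells of D, tagged with their sizes and listed in the order in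
-- which δ(D) lists the sizes: row r of a tabloid of shape δ(D) will fill cell
-- number r.  placeRows t i j is the row of t placed in cell (i , j).
module Cells {d : ℕ} (D : Fin d → Fin d → ℕ) where

  size : Tag d → ℕ
  size (i , j) = D i j

  tagged : List (Tag d × ℕ)
  tagged = map (λ p → (p , size p)) (rowMajor d)

  cells : List (Tag d × ℕ)
  cells = sortTagged (dropZeroTagged tagged)

  cells-sizes : map proj₂ cells ≡ δ D
  cells-sizes = begin
    map proj₂ cells                                                    ≡⟨ sortTagged-sizes (dropZeroTagged tagged) ⟩
    sortDesc (map proj₂ (dropZeroTagged tagged))                       ≡⟨ cong sortDesc (dropZeroTagged-sizes tagged) ⟩
    sortDesc (dropZeros (map proj₂ tagged))                            ≡⟨ cong (sortDesc ∘′ dropZeros) (map-∘ (rowMajor d)) ⟨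
    sortDesc (dropZeros (map size (rowMajor d)))                       ≡⟨ cong (sortDesc ∘′ dropZeros) (map-concatMap size _ (allFin d)) ⟩
    sortDesc (dropZeros (concatMap (λ i → map size (map (i ,_) (allFin d))) (allFin d)))
      ≡⟨ cong (sortDesc ∘′ dropZeros) (cong concat (map-cong (λ i → ≡.sym (map-∘ (allFin d))) (allFin d))) ⟩
    δ D                                                                ∎
    where
    open ≡.≡-Reasoning

  cells-unique : Unique (map proj₁ cells)
  cells-unique = unique-resp-↭ (↭-sym (↭-map⁺ proj₁ (sortTagged-↭ (dropZeroTagged tagged))))
    (dropZeroTagged-unique tagged (subst Unique (≡.trans (≡.sym (map-id (rowMajor d))) (map-∘ {g = proj₁} {f = λ p → (p , size p)} (rowMajor d))) (unique-rowMajor d)))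

  cells-size : ∀ {c} → c ∈ cells → proj₂ c ≡ size (proj₁ c)
  cells-size c∈ with ∈-map⁻ (λ p → (p , size p)) (dropZeroTagged-∈⁻ tagged (∈-resp-↭ (sortTagged-↭ (dropZeroTagged tagged)) c∈))
  ... | _ , _ , refl = refl

  cells-complete : ∀ p → size p ≢ 0 → p ∈ map proj₁ cells
  cells-complete p p≢0 = ∈-map⁺ proj₁ (∈-resp-↭ (↭-sym (sortTagged-↭ (dropZeroTagged tagged)))
    (dropZeroTagged-∈⁺ tagged (∈-map⁺ (λ p → (p , size p)) (∈-rowMajor p)) p≢0))


  placeRows : ∀ {X : Set} → List (List X) → Fin d → Fin d → List X
  placeRows t i j = RowAtTag.rowAtTag _≟ᵀ_ cells t (i , j)

  placeRows-length : ∀ {X : Set} (t : List (List X)) → map length t ≡ δ D → ∀ i j → length (placeRows t i j) ≡ D i j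
  placeRows-length t shape i j with DecMembership._∈?_ _≟ᵀ_ (i , j) (map proj₁ cells)
  ... | yes ij∈ = RowAtTag.rowAtTag-length _≟ᵀ_ size cells t (≡.trans shape (≡.sym cells-sizes)) cells-size (i , j) ij∈
  ... | no ij∉ with D i j in eq
  ...   | zero  = cong length (RowAtTag.rowAtTag-absent _≟ᵀ_ cells t (i , j) ij∉)
  ...   | suc _ = ⊥-elim (ij∉ (cells-complete (i , j) (λ D≡0 → 0≢1+n (≡.trans (≡.sym D≡0) eq))))

-- The central fact is that
-- permuting entries inside the cells does not change [S] ⊗ [T̄]
-- (reorder-cells): two entries of one cell lie in a common row of S and in a
-- common row of T̄, so exchanging them costs two signs which cancel.
module CellArrays {c ℓ} (F : Field c ℓ) (d n : ℕ) where
  open Field F renaming (refl to ≈-refl)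
  open Modules F d n
  open PP using (QuotEq; coeff)
  open FormalSums F PKey _≟P_ using (coeff-∷; δᵏ)
  open FormalSums.Span F PKey _≟P_ pgen
  open SignFacts F
  open import Data.Fin.Permutation using (Permutation′; _⟨$⟩ʳ_; transpose)
  open import Algebra.Solver.Ring.NaturalCoefficients.Default commutativeSemiring using (solve; _:+_; _:*_; _:=_; con)
  open import Relation.Binary.Reasoning.Setoid setoid

  CellArray : Set
  CellArray = Fin d → Fin d → List (Fin N)

  rowList colList : CellArray → Fin d → List (Fin N)
  rowList M i = concatMap (M i) (allFin d)
  colList M j = concatMap (λ i → M i j) (allFin d)

  arrays : CellArray → PKey
  arrays M = map (rowList M) (allFin d) , map (colList M) (allFin d)

  ValidKey : PKey → Set
  ValidKey (S , T) = ValidFilling arrayShape S × ValidFilling arrayShape T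

  ValidArray : CellArray → Set
  ValidArray M = ValidKey (arrays M)

  arrays-cong : ∀ {M M′ : CellArray} → (∀ i j → M i j ≡ M′ i j) → arrays M ≡ arrays M′
  arrays-cong M≡M′ = cong₂ _,_ (map-cong (λ i → cong concat (map-cong (M≡M′ i) (allFin d))) (allFin d))
                                (map-cong (λ j → cong concat (map-cong (λ i → M≡M′ i j) (allFin d))) (allFin d))

  arrays-act : ∀ (σ : Permutation′ N) M → (actF σ (proj₁ (arrays M)) , actF σ (proj₂ (arrays M))) ≡ arrays (λ i j → map (σ ⟨$⟩ʳ_) (M i j))
  arrays-act σ M = cong₂ _,_
    (≡.trans (≡.sym (map-∘ (allFin d))) (map-cong (λ i → map-concatMap (σ ⟨$⟩ʳ_) (M i) (allFin d)) (allFin d)))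
    (≡.trans (≡.sym (map-∘ (allFin d))) (map-cong (λ j → map-concatMap (σ ⟨$⟩ʳ_) (λ i → M i j) (allFin d)) (allFin d)))

  module _ {M : CellArray} (v : ValidArray M) where

    unique-cells : Unique (concatMap (λ p → M (proj₁ p) (proj₂ p)) (rowMajor d))
    unique-cells = subst Unique (concat-rows M) (proj₁ (proj₂ (proj₁ v)))

    cell-disjoint : ∀ {k i j i′ j′} → k ∈ M i j → k ∈ M i′ j′ → (i , j) ≡ (i′ , j′)
    cell-disjoint {i = i} {j} {i′} {j′} =
      unique-concatMap-disjoint (λ p → M (proj₁ p) (proj₂ p)) unique-cells (∈-rowMajor (i , j)) (∈-rowMajor (i′ , j′))

    cell-unique : ∀ i j → Unique (M i j)
    cell-unique i j = unique-concatMap-piece (λ p → M (proj₁ p) (proj₂ p)) unique-cells (∈-rowMajor (i , j))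

    row∩col : ∀ {k i j} → k ∈ rowList M i → k ∈ colList M j → k ∈ M i j
    row∩col {i = i} {j} k∈row k∈col with ∈-concatMap-elim (M i) {allFin d} k∈row | ∈-concatMap-elim (λ i → M i j) {allFin d} k∈col
    ... | j′ , _ , k∈ij′ | i′ , _ , k∈i′j with cell-disjoint k∈ij′ k∈i′j
    ... | refl = k∈ij′

    unique-row : ∀ i → Unique (rowList M i)
    unique-row i = unique-concatMap-piece (rowList M) (proj₁ (proj₂ (proj₁ v))) (∈-allFin i)

    unique-col : ∀ j → Unique (colList M j)
    unique-col j = unique-concatMap-piece (colList M) (proj₁ (proj₂ (proj₂ v))) (∈-allFin j)

    length-row : ∀ i → length (rowList M i) ≡ n
    length-row = map-tabulate-const⁻ (λ i → length (rowList M i)) (λ i → i) n (≡.trans (map-∘ (allFin d)) (proj₁ (proj₁ v)))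

    length-col : ∀ j → length (colList M j) ≡ n
    length-col = map-tabulate-const⁻ (λ j → length (colList M j)) (λ j → j) n (≡.trans (map-∘ (allFin d)) (proj₁ (proj₂ v)))

  sameRow-rows : ∀ (M : CellArray) {a b i j} → a ∈ M i j → b ∈ M i j → SameRow (proj₁ (arrays M)) a b
  sameRow-rows M {i = i} {j} a∈ b∈ =
    lose (∈-map⁺ (rowList M) (∈-allFin i)) (∈-concatMap-intro (M i) (∈-allFin j) a∈ , ∈-concatMap-intro (M i) (∈-allFin j) b∈)

  sameRow-cols : ∀ (M : CellArray) {a b i j} → a ∈ M i j → b ∈ M i j → SameRow (proj₂ (arrays M)) a b
  sameRow-cols M {i = i} {j} a∈ b∈ =
    lose (∈-map⁺ (colList M) (∈-allFin j)) (∈-concatMap-intro (λ i → M i j) (∈-allFin i) a∈ , ∈-concatMap-intro (λ i → M i j) (∈-allFin i) b∈)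

  _~_ : PKey → PKey → Set (c ⊔ ℓ)
  k ~ k′ = QuotEq pgen ((1# , k) ∷ []) ((1# , k′) ∷ [])

  ~-refl : ∀ {k} → k ~ k
  ~-refl {k} = quot-refl {(1# , k) ∷ []}

  ~-trans : ∀ {k₁ k₂ k₃} → k₁ ~ k₂ → k₂ ~ k₃ → k₁ ~ k₃
  ~-trans {k₁} {k₂} {k₃} = quot-trans {(1# , k₁) ∷ []} {(1# , k₂) ∷ []} {(1# , k₃) ∷ []}

  ~-≡ : ∀ {k₁ k₂} → k₁ ≡ k₂ → k₁ ~ k₂
  ~-≡ {k₁} refl = ~-refl {k₁}

  -- Exchanging a and b in S and in T̄, where they share a row in each, does
  -- not change [S] ⊗ [T̄]: the difference is (swapL relation) − (swapR
  -- relation for the already exchanged S).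
  swap-both : ∀ S T → ValidFilling arrayShape S → ValidFilling arrayShape T → ∀ a b → a ≢ b →
              SameRow S a b → SameRow T a b → (S , T) ~ (actF (transpose a b) S , actF (transpose a b) T)
  swap-both S T vS vT a b a≢b rowS rowT =
    ((1# , swapL S T vS vT a b a≢b rowS) ∷ (- 1# , swapR S′ T (actF-valid (transpose a b) arrayShape S vS) vT a b a≢b rowT) ∷ []) ,
    λ x → begin
      coeff ((1# , k₁) ∷ ((- 1#) * 1# , k₃) ∷ []) x
        ≈⟨ trans (coeff-∷ 1# k₁ _ x) (+-congˡ (trans (coeff-∷ ((- 1#) * 1#) k₃ [] x) (+-identityʳ _))) ⟩
      1# * δᵏ k₁ x + ((- 1#) * 1#) * δᵏ k₃ x
        ≈⟨ +-identityʳ _ ⟨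
      (1# * δᵏ k₁ x + ((- 1#) * 1#) * δᵏ k₃ x) + 0#
        ≈⟨ +-congˡ (x-x≈0 (δᵏ k₂ x)) ⟨
      (1# * δᵏ k₁ x + ((- 1#) * 1#) * δᵏ k₃ x) + (δᵏ k₂ x + (- 1#) * δᵏ k₂ x)
        ≈⟨ solve 4 (λ i₁ i₂ i₃ m → (con 1 :* i₁ :+ (m :* con 1) :* i₃) :+ (i₂ :+ m :* i₂)
                                 := (con 1 :* con 1) :* i₁ :+ ((con 1 :* con 1) :* i₂ :+ ((m :* con 1) :* i₂ :+ (m :* con 1) :* i₃)))
                   ≈-refl (δᵏ k₁ x) (δᵏ k₂ x) (δᵏ k₃ x) (- 1#) ⟩
      (1# * 1#) * δᵏ k₁ x + ((1# * 1#) * δᵏ k₂ x + (((- 1#) * 1#) * δᵏ k₂ x + ((- 1#) * 1#) * δᵏ k₃ x))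
        ≈⟨ trans (coeff-∷ _ k₁ _ x) (+-congˡ (trans (coeff-∷ _ k₂ _ x) (+-congˡ (trans (coeff-∷ _ k₂ _ x)
             (+-congˡ (trans (coeff-∷ _ k₃ [] x) (+-identityʳ _))))))) ⟨
      coeff ((1# * 1# , k₁) ∷ (1# * 1# , k₂) ∷ ((- 1#) * 1# , k₂) ∷ ((- 1#) * 1# , k₃) ∷ []) x ∎
    where
    S′ = actF (transpose a b) S
    k₁ k₂ k₃ : PKey
    k₁ = S , T
    k₂ = S′ , T
    k₃ = S′ , actF (transpose a b) T

  update : CellArray → Tag d → List (Fin N) → CellArray
  update M q l i j with (i , j) ≟ᵀ q
  ... | yes _ = l
  ... | no  _ = M i j

  update-at : ∀ M i j l → update M (i , j) l i j ≡ l
  update-at M i j l with (i , j) ≟ᵀ (i , j)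
  ... | yes _   = refl
  ... | no ij≢ij = ⊥-elim (ij≢ij refl)

  update-update : ∀ M q l l′ i j → update (update M q l) q l′ i j ≡ update M q l′ i j
  update-update M q l l′ i j with (i , j) ≟ᵀ q
  ... | yes _ = refl
  ... | no ij≢q with (i , j) ≟ᵀ q
  ...   | yes ij≡q = ⊥-elim (ij≢q ij≡q)
  ...   | no  _    = refl

  update-self : ∀ M i j l → M i j ≡ l → ∀ i′ j′ → update M (i , j) l i′ j′ ≡ M i′ j′
  update-self M i j l Mij≡l i′ j′ with (i′ , j′) ≟ᵀ (i , j)
  ... | yes refl = ≡.sym Mij≡l
  ... | no  _    = refl

  Reachable : CellArray → CellArray → Set (c ⊔ ℓ)
  Reachable M M′ = (arrays M ~ arrays M′) × ValidArray M′

  reachable-refl : ∀ {M} → ValidArray M → Reachable M M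
  reachable-refl {M} v = ~-refl {arrays M} , v

  reachable-trans : ∀ {M M₁ M₂} → Reachable M M₁ → Reachable M₁ M₂ → Reachable M M₂
  reachable-trans {M} {M₁} {M₂} (p , _) (q , v) = ~-trans {arrays M} {arrays M₁} {arrays M₂} p q , v

  reachable-≡ : ∀ {M M₁ M₂} → arrays M₁ ≡ arrays M₂ → Reachable M M₁ → Reachable M M₂
  reachable-≡ {M} e (p , v) = ~-trans {arrays M} p (~-≡ e) , subst ValidKey e v

  -- exchanging two adjacent entries x , y of one cell (swap-both with the
  -- transposition (x y), which fixes every other entry)
  swap-adjacent : ∀ M i j pre x y post → M i j ≡ pre ++ x ∷ y ∷ post → ValidArray M →
                  Reachable M (update M (i , j) (pre ++ y ∷ x ∷ post))
  swap-adjacent M i j pre x y post Mij≡ v =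
    ~-trans {arrays M} (swap-both _ _ (proj₁ v) (proj₂ v) x y x≢y (sameRow-rows M x∈ y∈) (sameRow-cols M x∈ y∈)) (~-≡ (≡.sym swapped)) ,
    subst ValidKey (≡.sym swapped) (actF-valid (transpose x y) arrayShape _ (proj₁ v) , actF-valid (transpose x y) arrayShape _ (proj₂ v))
    where
    open Transposition x y
    cell-split : Unique pre × Unique (x ∷ y ∷ post) × (∀ {z} → z ∈ pre → z ∉ x ∷ y ∷ post)
    cell-split = unique-++⁻ pre (subst Unique Mij≡ (cell-unique v i j))
    xy-post : Unique (x ∷ y ∷ post)
    xy-post = proj₁ (proj₂ cell-split)
    x≢y : x ≢ y
    x≢y x≡y with xy-post
    ... | x∉ ∷ _ = All.lookup x∉ (here refl) x≡y
    x∈ : x ∈ M i j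
    x∈ = subst (x ∈_) (≡.sym Mij≡) (∈-++⁺ʳ pre (here refl))
    y∈ : y ∈ M i j
    y∈ = subst (y ∈_) (≡.sym Mij≡) (∈-++⁺ʳ pre (there (here refl)))
    fixes : ∀ {l} → (∀ {z} → z ∈ l → z ≢ x × z ≢ y) → map (τ x≢y) l ≡ l
    fixes avoid = map-id-local (All.tabulate (λ z∈ → τ-fixed x≢y (proj₁ (avoid z∈)) (proj₂ (avoid z∈))))
    pre-avoids : ∀ {z} → z ∈ pre → z ≢ x × z ≢ y
    pre-avoids z∈ = (λ { refl → proj₂ (proj₂ cell-split) z∈ (here refl) }) , (λ { refl → proj₂ (proj₂ cell-split) z∈ (there (here refl)) })
    post-avoids : ∀ {z} → z ∈ post → z ≢ x × z ≢ y
    post-avoids z∈ with xy-post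
    ... | x∉ ∷ y∉ ∷ _ = (λ z≡x → All.lookup x∉ (there z∈) (≡.sym z≡x)) , (λ z≡y → All.lookup y∉ z∈ (≡.sym z≡y))
    cellwise : ∀ i′ j′ → update M (i , j) (pre ++ y ∷ x ∷ post) i′ j′ ≡ map (τ x≢y) (M i′ j′)
    cellwise i′ j′ with (i′ , j′) ≟ᵀ (i , j)
    ... | yes refl = ≡.sym (≡.trans (cong (map (τ x≢y)) Mij≡) (≡.trans (map-++ (τ x≢y) pre (x ∷ y ∷ post))
                       (cong₂ _++_ (fixes pre-avoids) (cong₂ _∷_ (τa x≢y) (cong₂ _∷_ (τb x≢y) (fixes post-avoids))))))
    ... | no ij′≢ij = ≡.sym (fixes (λ z∈ → (λ { refl → ij′≢ij (cell-disjoint v z∈ x∈) }) , (λ { refl → ij′≢ij (cell-disjoint v z∈ y∈) })))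
    swapped : arrays (update M (i , j) (pre ++ y ∷ x ∷ post)) ≡ (actF (transpose x y) (proj₁ (arrays M)) , actF (transpose x y) (proj₂ (arrays M)))
    swapped = ≡.trans (arrays-cong cellwise) (≡.sym (arrays-act (transpose x y) M))

  -- Any permutation of the suffix l of a cell pre ++ l is reachable, by
  -- induction on the permutation: swap steps are adjacent exchanges.
  permute-cell : ∀ {l l′} → l ↭ l′ → ∀ M i j pre → M i j ≡ pre ++ l → ValidArray M →
                 Reachable M (update M (i , j) (pre ++ l′))
  permute-cell ↭.refl M i j pre Mij≡ v =
    reachable-≡ {M} (≡.sym (arrays-cong (update-self M i j _ Mij≡))) (reachable-refl v)
  permute-cell (↭.prep {xs = l₁} {ys = l₁′} x p) M i j pre Mij≡ v =
    subst (λ l → Reachable M (update M (i , j) l)) (++-assoc pre (x ∷ []) l₁′)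
      (permute-cell p M i j (pre ++ x ∷ []) (≡.trans Mij≡ (≡.sym (++-assoc pre (x ∷ []) l₁))) v)
  permute-cell (↭.swap {xs = l₁} {ys = l₁′} x y p) M i j pre Mij≡ v =
    reachable-≡ {M} (arrays-cong (update-update M (i , j) _ _))
      (reachable-trans {M} rest (swap-adjacent M₁ i j pre x y l₁′ M₁ij≡ (proj₂ rest)))
    where
    rest : Reachable M (update M (i , j) ((pre ++ x ∷ y ∷ []) ++ l₁′))
    rest = permute-cell p M i j (pre ++ x ∷ y ∷ []) (≡.trans Mij≡ (≡.sym (++-assoc pre (x ∷ y ∷ []) l₁))) v
    M₁ = update M (i , j) ((pre ++ x ∷ y ∷ []) ++ l₁′)
    M₁ij≡ : M₁ i j ≡ pre ++ x ∷ y ∷ l₁′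
    M₁ij≡ = ≡.trans (update-at M i j _) (++-assoc pre (x ∷ y ∷ []) l₁′)
  permute-cell (↭.trans {ys = l₂} p q) M i j pre Mij≡ v =
    reachable-≡ {M} (arrays-cong (update-update M (i , j) _ _))
      (reachable-trans {M} first (permute-cell q (update M (i , j) (pre ++ l₂)) i j pre (update-at M i j _) (proj₂ first)))
    where first = permute-cell p M i j pre Mij≡ v

  -- Reordering every cell of a valid array does not change [S] ⊗ [T̄]: the
  -- cells are permuted one tag at a time (mix Q takes the cells of Q from M′).
  module _ (M M′ : CellArray) (v : ValidArray M) (M↭M′ : ∀ i j → M i j ↭ M′ i j) where

    mix : List (Tag d) → CellArray
    mix Q i j with DecMembership._∈?_ _≟ᵀ_ (i , j) Q
    ... | yes _ = M′ i j
    ... | no  _ = M i j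

    mix-step : ∀ q Q i j → update (mix Q) q (M′ (proj₁ q) (proj₂ q)) i j ≡ mix (q ∷ Q) i j
    mix-step q Q i j with (i , j) ≟ᵀ q
    mix-step q Q i j | yes refl with DecMembership._∈?_ _≟ᵀ_ (i , j) (q ∷ Q)
    ... | yes _  = refl
    ... | no ij∉ = ⊥-elim (ij∉ (here refl))
    mix-step q Q i j | no ij≢q with DecMembership._∈?_ _≟ᵀ_ (i , j) Q | DecMembership._∈?_ _≟ᵀ_ (i , j) (q ∷ Q)
    ... | yes _   | yes _          = refl
    ... | no  _   | no  _          = refl
    ... | yes ij∈ | no ij∉         = ⊥-elim (ij∉ (there ij∈))
    ... | no  _   | yes (here e)   = ⊥-elim (ij≢q e)
    ... | no ij∉  | yes (there ij∈) = ⊥-elim (ij∉ ij∈)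

    mix-all : ∀ i j → mix (rowMajor d) i j ≡ M′ i j
    mix-all i j with DecMembership._∈?_ _≟ᵀ_ (i , j) (rowMajor d)
    ... | yes _  = refl
    ... | no ij∉ = ⊥-elim (ij∉ (∈-rowMajor (i , j)))

    mix-↭ : ∀ Q i j → mix Q i j ↭ M′ i j
    mix-↭ Q i j with DecMembership._∈?_ _≟ᵀ_ (i , j) Q
    ... | yes _ = ↭-refl
    ... | no  _ = M↭M′ i j

    reachable-mix : ∀ Q → Reachable M (mix Q)
    reachable-mix []            = reachable-refl v
    reachable-mix ((i , j) ∷ Q) = reachable-≡ {M} (arrays-cong (mix-step (i , j) Q))
      (reachable-trans {M} (reachable-mix Q) (permute-cell (mix-↭ Q i j) (mix Q) i j [] refl (proj₂ (reachable-mix Q))))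

    reorder-cells : Reachable M M′
    reorder-cells = reachable-≡ {M} (arrays-cong mix-all) (reachable-mix (rowMajor d))

module Correspondence {c ℓ} (F : Field c ℓ) (d n : ℕ) (D : Fin d → Fin d → ℕ)
                      (corr : IsCorrelatedDiagram d n D) where
  open Field F renaming (refl to ≈-refl)
  open SignFacts F
  open Modules F d n
  open CellArrays F d n
  open Cells D
  open RowAtTag {Tag d} {Fin N} _≟ᵀ_

  rows-shape : ∀ (M : CellArray) → (∀ i j → length (M i j) ≡ D i j) → map length (proj₁ (arrays M)) ≡ arrayShape
  rows-shape M sizes = ≡.trans (≡.sym (map-∘ (allFin d))) (map-tabulate-const _ (λ i → i) n λ i →
    ≡.trans (length-concatMap (M i) (allFin d)) (≡.trans (cong sum (map-cong (sizes i) (allFin d))) (proj₁ corr i)))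

  cols-shape : ∀ (M : CellArray) → (∀ i j → length (M i j) ≡ D i j) → map length (proj₂ (arrays M)) ≡ arrayShape
  cols-shape M sizes = ≡.trans (≡.sym (map-∘ (allFin d))) (map-tabulate-const _ (λ j → j) n λ j →
    ≡.trans (length-concatMap (λ i → M i j) (allFin d)) (≡.trans (cong sum (map-cong (λ i → sizes i j) (allFin d))) (proj₂ corr j)))

  valid-array : ∀ (M : CellArray) L → (∀ i j → length (M i j) ≡ D i j) →
                concat (proj₁ (arrays M)) ↭ L → concat (proj₂ (arrays M)) ↭ L →
                Unique L → (∀ k → k ∈ L) → ValidArray M
  valid-array M L sizes rows↭ cols↭ u cover =
    (rows-shape M sizes , unique-resp-↭ (↭-sym rows↭) u , λ k → ∈-resp-↭ (↭-sym rows↭) (cover k)) ,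
    (cols-shape M sizes , unique-resp-↭ (↭-sym cols↭) u , λ k → ∈-resp-↭ (↭-sym cols↭) (cover k))

  -- The cell array of a tabloid: row r of t is placed in the r-th nonzero
  -- cell of D.  Its rows and columns flatten to permutations of the entries
  -- of t, so it is valid when t is.
  placed : Filling N → CellArray
  placed t = placeRows t

  length-rows : ∀ (t : Filling N) → map length t ≡ δ D → length t ≡ length cells
  length-rows t shape = ≡.trans (≡.sym (length-map length t))
    (≡.trans (cong length (≡.trans shape (≡.sym cells-sizes))) (length-map proj₂ cells))

  placed-flatten : ∀ (t : Filling N) {Q} → Unique Q → (∀ p → p ∈ Q) → length t ≡ length cells →
                   concatMap (λ p → placed t (proj₁ p) (proj₂ p)) Q ↭ concat t
  placed-flatten t uQ complete len =
    ↭-trans (concatMap-restrict _≟ᵀ_ (rowAtTag cells t) uQ cells-unique (λ _ → complete _) (λ _ p∉ → rowAtTag-absent cells t _ p∉))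
      (subst (λ z → concat z ↭ concat t) (≡.trans (≡.sym (rowAtTag-all cells t cells-unique len)) (map-∘ cells)) ↭-refl)

  placed-valid : ∀ (t : Filling N) → ValidFilling (δ D) t → ValidArray (placed t)
  placed-valid t (shape , u , cover) = valid-array (placed t) (concat t) (placeRows-length t shape)
    (subst (_↭ concat t) (≡.sym (concat-rows (placed t))) (placed-flatten t (unique-rowMajor d) ∈-rowMajor len))
    (subst (_↭ concat t) (≡.sym (concat-columns (placed t))) (placed-flatten t (unique-colMajor d) ∈-colMajor len))
    u cover
    where len = length-rows t shape

  ⋃-row : ∀ (M : CellArray) i → ⋃ (map (λ j → fromList (M i j)) (allFin d)) ≡ fromList (rowList M i)
  ⋃-row M i = ⊆-antisym
    (λ k∈ → let (j , j∈ , k∈ij) = find (Any.map⁻ {f = λ j → fromList (M i j)} (∈-⋃⁻ (map (λ j → fromList (M i j)) (allFin d)) k∈)) in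
      ∈-fromList⁺ (∈-concatMap-intro (M i) j∈ (∈-fromList⁻ (M i j) k∈ij)))
    (λ k∈ → let (j , j∈ , k∈ij) = ∈-concatMap-elim (M i) {allFin d} (∈-fromList⁻ (rowList M i) k∈) in
      ∈-⋃⁺ _ (lose (∈-map⁺ (λ j → fromList (M i j)) j∈) (∈-fromList⁺ k∈ij)))

  ⋃-col : ∀ (M : CellArray) j → ⋃ (map (λ i → fromList (M i j)) (allFin d)) ≡ fromList (colList M j)
  ⋃-col M j = ⊆-antisym
    (λ k∈ → let (i , i∈ , k∈ij) = find (Any.map⁻ {f = λ i → fromList (M i j)} (∈-⋃⁻ (map (λ i → fromList (M i j)) (allFin d)) k∈)) in
      ∈-fromList⁺ (∈-concatMap-intro (λ i → M i j) i∈ (∈-fromList⁻ (M i j) k∈ij)))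
    (λ k∈ → let (i , i∈ , k∈ij) = ∈-concatMap-elim (λ i → M i j) {allFin d} (∈-fromList⁻ (colList M j) k∈) in
      ∈-⋃⁺ _ (lose (∈-map⁺ (λ i → fromList (M i j)) i∈) (∈-fromList⁺ k∈ij)))

  toTableau : ∀ (M : CellArray) → ValidArray M → (∀ i j → length (M i j) ≡ D i j) → TableauOfShape D
  toTableau M v sizes = tableau , λ i j → ≡.trans (card-fromList (cell-unique v i j)) (sizes i j)
    where
    tableau : CorrelatedTableau d n
    tableau = record
      { cell      = λ i j → fromList (M i j)
      ; partition = λ k → let (p , _ , k∈) = ∈-concatMap-elim (λ p → M (proj₁ p) (proj₂ p)) {rowMajor d}
                                                (subst (k ∈_) (concat-rows M) (proj₂ (proj₂ (proj₁ v)) k)) in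
                    p , ∈-fromList⁺ k∈ , λ i j k∈ij → cell-disjoint v (∈-fromList⁻ (M i j) k∈ij) k∈
      ; rowUnion  = λ i → ≡.trans (cong ∣_∣ (⋃-row M i)) (≡.trans (card-fromList (unique-row v i)) (length-row v i))
      ; colUnion  = λ j → ≡.trans (cong ∣_∣ (⋃-col M j)) (≡.trans (card-fromList (unique-col v j)) (length-col v j))
      }

  -- sorting every cell; associated (toTableau M …) is arrays (sortCells M)
  sortCells : CellArray → CellArray
  sortCells M i j = elems (fromList (M i j))

  sortCells-reachable : ∀ M → ValidArray M → Reachable M (sortCells M)
  sortCells-reachable M v = reorder-cells M (sortCells M) v (λ i j → ↭-sym (elems-fromList-↭ (cell-unique v i j)))

  φkey : Filling N → PP.FSum
  φkey t with valid? (δ D) t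
  ... | yes _ = (1# , arrays (placed t)) ∷ []
  ... | no  _ = []

  φkey-valid : ∀ t → ValidFilling (δ D) t → φkey t ≡ (1# , arrays (placed t)) ∷ []
  φkey-valid t vt with valid? (δ D) t
  ... | yes _  = refl
  ... | no ¬vt = ⊥-elim (¬vt vt)

  φkey-invalid : ∀ t → ¬ ValidFilling (δ D) t → φkey t ≡ []
  φkey-invalid t ¬vt with valid? (δ D) t
  ... | yes vt = ⊥-elim (¬vt vt)
  ... | no  _  = refl

  -- The tabloid of a correlated tableau C of shape D: its r-th row lists the
  -- r-th nonzero cell of C.  Its cell array is C itself, so φ sends it to the
  -- element associated to C.
  module TabloidOf (CT : TableauOfShape D) where
    private
      C = proj₁ CT

    cellList : Tag d → List (Fin N)
    cellList (i , j) = elems (cell C i j)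

    tabloid : Filling N
    tabloid = map (λ c → cellList (proj₁ c)) cells

    placed-tabloid : ∀ i j → placed tabloid i j ≡ cellList (i , j)
    placed-tabloid i j with DecMembership._∈?_ _≟ᵀ_ (i , j) (map proj₁ cells)
    ... | yes ij∈ = rowAtTag-tabulate cells cellList (i , j) cells-unique ij∈
    ... | no ij∉ with D i j in eq
    ...   | zero  = ≡.trans (rowAtTag-absent cells tabloid (i , j) ij∉)
                      (≡.sym (length-zero (≡.trans (≡.sym (card-elems (cell C i j))) (≡.trans (proj₂ CT i j) eq))))
    ...   | suc _ = ⊥-elim (ij∉ (cells-complete (i , j) (λ D≡0 → 0≢1+n (≡.trans (≡.sym D≡0) eq))))

    arrays-tabloid : arrays (placed tabloid) ≡ associated C
    arrays-tabloid = arrays-cong placed-tabloid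

    shape-tabloid : map length tabloid ≡ δ D
    shape-tabloid = ≡.trans (≡.sym (map-∘ cells))
      (≡.trans (map-cong-local (All.tabulate λ {c} c∈ →
                  ≡.trans (≡.sym (card-elems (cell C (proj₁ (proj₁ c)) (proj₂ (proj₁ c)))))
                          (≡.trans (proj₂ CT _ _) (≡.sym (cells-size c∈)))))
               cells-sizes)

    unique-cellLists : Unique (concatMap cellList (rowMajor d))
    unique-cellLists = unique-concatMap⁺ cellList (unique-rowMajor d) (λ {p} _ → unique-elems (cell C (proj₁ p) (proj₂ p)))
      λ {p} {q} {k} _ _ k∈p k∈q → let (_ , _ , only) = partition C k in
        ≡.trans (only (proj₁ p) (proj₂ p) (∈-elems⁻ _ k∈p)) (≡.sym (only (proj₁ q) (proj₂ q) (∈-elems⁻ _ k∈q)))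

    cover-cellLists : ∀ k → k ∈ concatMap cellList (rowMajor d)
    cover-cellLists k = let (p , k∈p , _) = partition C k in
      ∈-concatMap-intro cellList (∈-rowMajor p) (∈-elems⁺ (cell C (proj₁ p) (proj₂ p)) k∈p)

    valid-tabloid : ValidFilling (δ D) tabloid
    valid-tabloid = shape-tabloid , unique-resp-↭ flattened unique-cellLists , λ k → ∈-resp-↭ flattened (cover-cellLists k)
      where
      flattened : concatMap cellList (rowMajor d) ↭ concat tabloid
      flattened = subst (_↭ concat tabloid) (concatMap-cong (λ p → placed-tabloid (proj₁ p) (proj₂ p)) (rowMajor d))
        (placed-flatten tabloid (unique-rowMajor d) ∈-rowMajor (length-rows tabloid shape-tabloid))

    φkey-tabloid : φkey tabloid ≡ (1# , associated C) ∷ []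
    φkey-tabloid = ≡.trans (φkey-valid tabloid valid-tabloid) (cong (λ k → (1# , k) ∷ []) arrays-tabloid)

  -- The sign ε compares the inversion parities of S
  -- and T̄ with those of the arrays rebuilt from meet S T; it flips under a
  -- transposition inside a row of S or of T̄ (which does not change the meet),
  -- and it is + when (S , T̄) is itself built from its meet.
  meet : Filling N → Filling N → CellArray
  meet S T i j = elems (fromList (rowAt S i) ∩ fromList (rowAt T j))

  meetTabloid : Filling N → Filling N → Filling N
  meetTabloid S T = map (λ c → meet S T (proj₁ (proj₁ c)) (proj₂ (proj₁ c))) cells

  meetParity : Filling N → Filling N → Bool
  meetParity S T = inversionParity (concat (proj₁ (arrays (meet S T)))) xor inversionParity (concat (proj₂ (arrays (meet S T))))

  ε : Filling N → Filling N → Bool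
  ε S T = inversionParity (concat S) xor (inversionParity (concat T) xor meetParity S T)

  sign : Bool → Carrier
  sign false = 1#
  sign true  = - 1#

  sign-not : ∀ b → sign (not b) ≈ (- 1#) * sign b
  sign-not false = sym (*-identityʳ (- 1#))
  sign-not true  = sym -1*-1≈1

  ψkey : PKey → RR.FSum
  ψkey (S , T) with valid? arrayShape S | valid? arrayShape T
  ... | yes _ | yes _ = (sign (ε S T) , meetTabloid S T) ∷ []
  ... | yes _ | no  _ = []
  ... | no  _ | _     = []

  ψkey-valid : ∀ S T → ValidKey (S , T) → ψkey (S , T) ≡ (sign (ε S T) , meetTabloid S T) ∷ []
  ψkey-valid S T (vS , vT) with valid? arrayShape S | valid? arrayShape T
  ... | yes _  | yes _  = refl
  ... | yes _  | no ¬vT = ⊥-elim (¬vT vT)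
  ... | no ¬vS | _      = ⊥-elim (¬vS vS)

  ψkey-invalid : ∀ S T → ¬ ValidKey (S , T) → ψkey (S , T) ≡ []
  ψkey-invalid S T ¬v with valid? arrayShape S | valid? arrayShape T
  ... | yes vS | yes vT = ⊥-elim (¬v (vS , vT))
  ... | yes _  | no  _  = refl
  ... | no  _  | _      = refl

  module _ {S : Filling N} (T : Filling N) (vS : ValidFilling arrayShape S) {a b : Fin N} (a≢b : a ≢ b) (row : SameRow S a b) where
    open import Data.Fin.Permutation using (transpose)
    private
      module Swap = SwapInRow S (proj₁ (proj₂ vS)) a b a≢b row
      S′ = actF (transpose a b) S

    meet-swapˡ : ∀ i j → meet S′ T i j ≡ meet S T i j
    meet-swapˡ i j = cong (λ X → elems (X ∩ fromList (rowAt T j))) (Swap.rowAt-swap i)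

    meet-swapʳ : ∀ i j → meet T S′ i j ≡ meet T S i j
    meet-swapʳ i j = cong (λ X → elems (fromList (rowAt T i) ∩ X)) (Swap.rowAt-swap j)

    ε-swapˡ : ε S′ T ≡ not (ε S T)
    ε-swapˡ = ≡.trans (cong₂ (λ p M → p xor (inversionParity (concat T) xor inversionParity (concat (proj₁ M)) xor inversionParity (concat (proj₂ M))))
                             Swap.inversionParity-swap (arrays-cong meet-swapˡ))
                      (≡.sym (not-distribˡ-xor (inversionParity (concat S)) _))

    ε-swapʳ : ε T S′ ≡ not (ε T S)
    ε-swapʳ = ≡.trans (cong₂ (λ p M → inversionParity (concat T) xor (p xor inversionParity (concat (proj₁ M)) xor inversionParity (concat (proj₂ M))))
                             Swap.inversionParity-swap (arrays-cong meet-swapʳ))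
                      (≡.trans (cong (inversionParity (concat T) xor_) (≡.sym (not-distribˡ-xor (inversionParity (concat S)) _)))
                               (≡.sym (not-distribʳ-xor (inversionParity (concat T)) _)))

    meetTabloid-swapˡ : meetTabloid S′ T ≡ meetTabloid S T
    meetTabloid-swapˡ = map-cong (λ c → meet-swapˡ (proj₁ (proj₁ c)) (proj₂ (proj₁ c))) cells

    meetTabloid-swapʳ : meetTabloid T S′ ≡ meetTabloid T S
    meetTabloid-swapʳ = map-cong (λ c → meet-swapʳ (proj₁ (proj₁ c)) (proj₂ (proj₁ c))) cells

  private
    module SpanP = FormalSums.Span F PKey _≟P_ pgen
    module SpanR = FormalSums.Span F (Filling N) _≟F_ (rgen {δ D})
    module SumsP = FormalSums F PKey _≟P_
    module SumsR = FormalSums F (Filling N) _≟F_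
    module Ψ = LinearExtension F PKey _≟P_ (Filling N) _≟F_ ψkey
    module Φ = LinearExtension F (Filling N) _≟F_ PKey _≟P_ φkey

  ψ : PP.FSum → RR.FSum
  ψ = Ψ.extend

  φ : RR.FSum → PP.FSum
  φ = Φ.extend

  opposite-signs : ∀ s t → RR.InSpan (rgen {δ D}) ((1# * sign s , t) ∷ (1# * sign (not s) , t) ∷ [])
  opposite-signs s t = SpanR.span-zero {(1# * sign s , t) ∷ (1# * sign (not s) , t) ∷ []} λ x → begin
    RR.coeff ((1# * sign s , t) ∷ (1# * sign (not s) , t) ∷ []) x
      ≈⟨ trans (SumsR.coeff-∷ _ t _ x) (+-congˡ (trans (SumsR.coeff-∷ _ t [] x) (+-identityʳ _))) ⟩
    (1# * sign s) * SumsR.δᵏ t x + (1# * sign (not s)) * SumsR.δᵏ t x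
      ≈⟨ +-congˡ (*-congʳ (*-congˡ (sign-not s))) ⟩
    (1# * sign s) * SumsR.δᵏ t x + (1# * ((- 1#) * sign s)) * SumsR.δᵏ t x
      ≈⟨ solve 3 (λ A I m → (con 1 :* A) :* I :+ (con 1 :* (m :* A)) :* I := A :* I :+ m :* (A :* I)) ≈-refl (sign s) (SumsR.δᵏ t x) (- 1#) ⟩
    sign s * SumsR.δᵏ t x + (- 1#) * (sign s * SumsR.δᵏ t x)
      ≈⟨ x-x≈0 _ ⟩
    0# ∎
    where
    open import Algebra.Solver.Ring.NaturalCoefficients.Default commutativeSemiring using (solve; _:+_; _:*_; _:=_; con)
    open import Relation.Binary.Reasoning.Setoid setoid

  -- ψ kills the defining relations of P(d) ⊗ P̄(d): the two symbols of a
  -- row-exchange relation have the same meet and opposite signs.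
  ψ-relations : ∀ g → RR.InSpan (rgen {δ D}) (ψ (pgen g))
  ψ-relations (swapL S T vS vT a b a≢b row) =
    subst (RR.InSpan rgen) (≡.sym (cong₂ (λ u v → (1# RR.⊙ u) ++ ((1# RR.⊙ v) ++ [])) (ψkey-valid S T (vS , vT))
      (≡.trans (ψkey-valid _ T (actF-valid (transpose a b) arrayShape S vS , vT))
               (cong₂ (λ s t → (sign s , t) ∷ []) (ε-swapˡ T vS a≢b row) (meetTabloid-swapˡ T vS a≢b row)))))
      (opposite-signs (ε S T) (meetTabloid S T))
    where open import Data.Fin.Permutation using (transpose)
  ψ-relations (swapR S T vS vT a b a≢b row) =
    subst (RR.InSpan rgen) (≡.sym (cong₂ (λ u v → (1# RR.⊙ u) ++ ((1# RR.⊙ v) ++ [])) (ψkey-valid S T (vS , vT))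
      (≡.trans (ψkey-valid S _ (vS , actF-valid (transpose a b) arrayShape T vT))
               (cong₂ (λ s t → (sign s , t) ∷ []) (ε-swapʳ S vT a≢b row) (meetTabloid-swapʳ S vT a≢b row)))))
      (opposite-signs (ε S T) (meetTabloid S T))
    where open import Data.Fin.Permutation using (transpose)
  ψ-relations (invalid S T ¬v) =
    subst (RR.InSpan rgen) (≡.sym (cong (λ u → (1# RR.⊙ u) ++ []) (ψkey-invalid S T ¬v))) (SpanR.span-zero {[]} (λ _ → ≈-refl))

  ψ-well-defined : ∀ {u v} → u ≈P v → ψ u ≈R[ δ D ] ψ v
  ψ-well-defined {u} {v} = Ψ.extend-quot pgen rgen ψ-relations {u} {v}

  -- A valid cell array with sorted cells is the meet of its own
  -- arrays, so its sign is + and ψ gives back the tabloid with sorted rows,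
  -- which equals the original tabloid in R(δ(D)).
  meet-arrays : ∀ (M : CellArray) → ValidArray M → (∀ i j → elems (fromList (M i j)) ≡ M i j) →
                ∀ i j → meet (proj₁ (arrays M)) (proj₂ (arrays M)) i j ≡ M i j
  meet-arrays M v sorted i j = ≡.trans (cong elems same-set) (sorted i j)
    where
    same-set : fromList (rowAt (proj₁ (arrays M)) i) ∩ fromList (rowAt (proj₂ (arrays M)) j) ≡ fromList (M i j)
    same-set rewrite rowAt-tabulate (rowList M) (λ i → i) i | rowAt-tabulate (colList M) (λ j → j) j = ⊆-antisym
      (λ k∈ → let (k∈row , k∈col) = x∈p∩q⁻ (fromList (rowList M i)) (fromList (colList M j)) k∈ in
        ∈-fromList⁺ (row∩col v (∈-fromList⁻ (rowList M i) k∈row) (∈-fromList⁻ (colList M j) k∈col)))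
      (λ k∈ → let k∈ij = ∈-fromList⁻ (M i j) k∈ in
        x∈p∩q⁺ (∈-fromList⁺ (∈-concatMap-intro (M i) (∈-allFin j) k∈ij) , ∈-fromList⁺ (∈-concatMap-intro (λ i → M i j) (∈-allFin i) k∈ij)))

  sortRows : Filling N → Filling N
  sortRows = map (λ r → elems (fromList r))

  ψkey-sorted : ∀ t → ValidFilling (δ D) t → ψkey (arrays (sortCells (placed t))) ≡ (1# , sortRows t) ∷ []
  ψkey-sorted t vt = ≡.trans (ψkey-valid S T valid) (cong₂ (λ s r → (sign s , r) ∷ []) ε≡+ tabloid≡)
    where
    M = sortCells (placed t)
    S = proj₁ (arrays M)
    T = proj₂ (arrays M)
    valid : ValidArray M
    valid = proj₂ (sortCells-reachable (placed t) (placed-valid t vt))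
    meet≡ : ∀ i j → meet S T i j ≡ M i j
    meet≡ = meet-arrays M valid (λ i j → cong elems (fromList-elems (fromList (placed t i j))))
    ε≡+ : ε S T ≡ false
    ε≡+ = ≡.trans (cong (λ K → inversionParity (concat S) xor (inversionParity (concat T) xor
                                 (inversionParity (concat (proj₁ K)) xor inversionParity (concat (proj₂ K)))))
                        (arrays-cong meet≡))
                  (cancel (inversionParity (concat S)) (inversionParity (concat T)))
      where
      cancel : ∀ p q → p xor (q xor (p xor q)) ≡ false
      cancel false false = refl
      cancel false true  = refl
      cancel true  false = refl
      cancel true  true  = refl
    tabloid≡ : meetTabloid S T ≡ sortRows t
    tabloid≡ = ≡.trans (map-cong (λ c → meet≡ (proj₁ (proj₁ c)) (proj₂ (proj₁ c))) cells)
      (≡.trans (map-∘ cells) (cong sortRows (rowAtTag-all cells t cells-unique (length-rows t (proj₁ vt)))))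

  sortRows-↭ : ∀ (t : Filling N) → (∀ {r} → r ∈ t → Unique r) → Pointwise _↭_ (sortRows t) t
  sortRows-↭ []      u = []
  sortRows-↭ (r ∷ t) u = elems-fromList-↭ (u (here refl)) ∷ sortRows-↭ t (λ r∈ → u (there r∈))

  sortRows-valid : ∀ t → ValidFilling (δ D) t → ValidFilling (δ D) (sortRows t)
  sortRows-valid t (shape , u , cover) =
    ≡.trans (≡.sym (map-∘ t)) (≡.trans (map-cong-local (All.tabulate λ r∈ → ↭-length (elems-fromList-↭ (unique-concat-row u r∈)))) shape) ,
    unique-resp-↭ (↭-sym flat) u , λ k → ∈-resp-↭ (↭-sym flat) (cover k)
    where
    flat : concat (sortRows t) ↭ concat t
    flat = concat-↭ (sortRows-↭ t (unique-concat-row u))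

  sortRows-same : ∀ t → ValidFilling (δ D) t → ((1# , sortRows t) ∷ []) ≈R[ δ D ] ((1# , t) ∷ [])
  sortRows-same t vt@(_ , u , _) =
    SpanR.span-resp {(1# , sortRows t) ∷ ((- 1#) * 1# , t) ∷ []} {(1# , sortRows t) ∷ (- 1# , t) ∷ []}
      (SumsR.∷-cong (sortRows t) ≈-refl (SumsR.∷-cong t (*-identityʳ (- 1#)) (λ _ → ≈-refl)))
      (SpanR.span-gen (rowEq (sortRows t) t (sortRows-valid t vt) vt (sortRows-↭ t (unique-concat-row u))))

  -- on one filling: a non-tabloid is 0 in R; for a tabloid t, sort the cells
  -- of its cell array (same symbol), apply ψ (sign +) and unsort the rows
  ψφ-single : ∀ t → ψ (φkey t) ≈R[ δ D ] ((1# , t) ∷ [])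
  ψφ-single t with valid? (δ D) t
  ... | no ¬vt = SpanR.span-⊙ (- 1#) {(1# , t) ∷ []} (SpanR.span-gen (invalid t ¬vt))
  ... | yes vt = SpanR.quot-trans {ψ ((1# , K) ∷ [])} {ψ ((1# , K′) ∷ [])} {(1# , t) ∷ []}
      (ψ-well-defined {(1# , K) ∷ []} {(1# , K′) ∷ []} (proj₁ (sortCells-reachable (placed t) (placed-valid t vt))))
      (SpanR.quot-trans {ψ ((1# , K′) ∷ [])} {(1# , sortRows t) ∷ []} {(1# , t) ∷ []}
        (SpanR.quot-≈ {ψ ((1# , K′) ∷ [])} {(1# , sortRows t) ∷ []}
          (λ x → trans (Ψ.extend-single K′ x) (reflexive (cong (λ z → RR.coeff z x) (ψkey-sorted t vt)))))
        (sortRows-same t vt))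
    where
    K  = arrays (placed t)
    K′ = arrays (sortCells (placed t))

  ψφ : ∀ x → ψ (φ x) ≈R[ δ D ] x
  ψφ []            = SpanR.quot-refl {[]}
  ψφ ((a , t) ∷ x) = subst (λ z → z ≈R[ δ D ] ((a , t) ∷ x)) (≡.sym (Ψ.extend-++ (a PP.⊙ φkey t) (φ x)))
    (SpanR.quot-++ {ψ (a PP.⊙ φkey t)} {(a , t) ∷ []} {ψ (φ x)} {x} head (ψφ x))
    where
    head : ψ (a PP.⊙ φkey t) ≈R[ δ D ] ((a , t) ∷ [])
    head = SpanR.quot-trans {ψ (a PP.⊙ φkey t)} {a RR.⊙ ψ (φkey t)} {(a , t) ∷ []}
      (SpanR.quot-≈ {ψ (a PP.⊙ φkey t)} {a RR.⊙ ψ (φkey t)} (Ψ.extend-⊙ a (φkey t)))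
      (SpanR.quot-trans {a RR.⊙ ψ (φkey t)} {a RR.⊙ ((1# , t) ∷ [])} {(a , t) ∷ []}
        (SpanR.quot-⊙ a {ψ (φkey t)} {(1# , t) ∷ []} (ψφ-single t))
        (SpanR.quot-≈ {(a * 1# , t) ∷ []} {(a , t) ∷ []} (SumsR.∷-cong t (*-identityʳ a) (λ _ → ≈-refl))))

  -- φ respects the relations of R(δ(D)): tabloids with the same row sets give
  -- cell arrays differing by a reordering inside the cells.
  φ-relations : ∀ g → PP.InSpan pgen (φ (rgen {δ D} g))
  φ-relations (rowEq t t′ vt vt′ rows↭) =
    subst (PP.InSpan pgen) (≡.sym (cong₂ (λ u v → (1# PP.⊙ u) ++ (((- 1#) PP.⊙ v) ++ [])) (φkey-valid t vt) (φkey-valid t′ vt′)))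
      (SpanP.span-resp {(1# * 1# , K) ∷ ((- 1#) * 1# , K′) ∷ []} {(1# , K) ∷ ((- 1#) * 1# , K′) ∷ []}
        (SumsP.∷-cong K (*-identityˡ 1#) (λ _ → ≈-refl)) K~K′)
    where
    K  = arrays (placed t)
    K′ = arrays (placed t′)
    K~K′ : K ~ K′
    K~K′ = proj₁ (reorder-cells (placed t) (placed t′) (placed-valid t vt) (λ i j → rowAtTag-pointwise ↭-refl cells rows↭ (i , j)))
  φ-relations (invalid t ¬vt) =
    subst (PP.InSpan pgen) (≡.sym (cong (λ u → (1# PP.⊙ u) ++ []) (φkey-invalid t ¬vt))) (SpanP.span-zero {[]} (λ _ → ≈-refl))

  φ-well-defined : ∀ x y → x ≈R[ δ D ] y → φ x ≈P φ y
  φ-well-defined x y = Φ.extend-quot (rgen {δ D}) pgen φ-relations {x} {y}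

  φkey-equivariant : ∀ σ t → φkey (actF σ t) ≡ actP σ (φkey t)
  φkey-equivariant σ t with valid? (δ D) t
  ... | no ¬vt = φkey-invalid (actF σ t) (λ v → ¬vt (actF-valid⁻ σ _ t v))
  ... | yes vt = ≡.trans (φkey-valid (actF σ t) (actF-valid σ _ t vt))
      (cong (λ k → (1# , k) ∷ []) (≡.trans (arrays-cong (λ i j → rowAtTag-map (map (σ ⟨$⟩ʳ_)) refl cells t (i , j)))
                                            (≡.sym (arrays-act σ (placed t)))))
    where open import Data.Fin.Permutation using (_⟨$⟩ʳ_)

  φ-act : ∀ σ x → φ (actR σ x) ≡ actP σ (φ x)
  φ-act σ []            = refl
  φ-act σ ((a , t) ∷ x) = ≡.trans
    (cong₂ _++_ (≡.trans (cong (a PP.⊙_) (φkey-equivariant σ t)) (act-⊙ (φkey t))) (φ-act σ x))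
    (≡.sym (map-++ _ (a PP.⊙ φkey t) (φ x)))
    where
    act-⊙ : ∀ v → a PP.⊙ actP σ v ≡ actP σ (a PP.⊙ v)
    act-⊙ []      = refl
    act-⊙ (_ ∷ v) = cong (_ ∷_) (act-⊙ v)

  tableauOf : ∀ t → ValidFilling (δ D) t → TableauOfShape D
  tableauOf t vt = toTableau (placed t) (placed-valid t vt) (placeRows-length t (proj₁ vt))

  φkey-in-C : ∀ t vt → ((1# , arrays (placed t)) ∷ []) ≈P assocElem (tableauOf t vt)
  φkey-in-C t vt = proj₁ (sortCells-reachable (placed t) (placed-valid t vt))

  combination : List (Carrier × TableauOfShape D) → PP.FSum
  combination cs = PP.lincomb (map (λ p → (proj₁ p , assocElem (proj₂ p))) cs)

  φ-into-C : ∀ x → InC D (φ x)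
  φ-into-C []            = [] , SpanP.quot-refl {[]}
  φ-into-C ((a , t) ∷ x) = cons (valid? (δ D) t) (φ-into-C x)
    where
    cons : Dec (ValidFilling (δ D) t) → InC D (φ x) → InC D ((a PP.⊙ φkey t) ++ φ x)
    cons (yes vt) (cs , φx≈) = ((a , tableauOf t vt) ∷ cs) ,
      subst (λ z → ((a PP.⊙ z) ++ φ x) ≈P combination ((a , tableauOf t vt) ∷ cs)) (≡.sym (φkey-valid t vt))
        (SpanP.quot-++ {a PP.⊙ ((1# , arrays (placed t)) ∷ [])} {a PP.⊙ assocElem (tableauOf t vt)} {φ x} {combination cs}
          (SpanP.quot-⊙ a {(1# , arrays (placed t)) ∷ []} {assocElem (tableauOf t vt)} (φkey-in-C t vt)) φx≈)
    cons (no ¬vt) (cs , φx≈) = cs , subst (λ z → ((a PP.⊙ z) ++ φ x) ≈P combination cs) (≡.sym (φkey-invalid t ¬vt)) φx≈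

  -- every element of C(D) is hit: the element associated to a tableau is φ of
  -- its tabloid
  φ-tabloids : ∀ cs → φ (map (λ p → (proj₁ p , TabloidOf.tabloid (proj₂ p))) cs) ≡ combination cs
  φ-tabloids []             = refl
  φ-tabloids ((a , CT) ∷ cs) = cong₂ _++_ (cong (a PP.⊙_) (TabloidOf.φkey-tabloid CT)) (φ-tabloids cs)

  φ-onto-C : ∀ y → InC D y → Σ RR.FSum λ x → φ x ≈P y
  φ-onto-C y (cs , y≈) = x , SpanP.quot-trans {φ x} {combination cs} {y}
      (SpanP.quot-≡ {φ x} (φ-tabloids cs)) (SpanP.quot-sym {y} {combination cs} y≈)
    where x = map (λ p → (proj₁ p , TabloidOf.tabloid (proj₂ p))) cs

  φ-injective : ∀ x y → φ x ≈P φ y → x ≈R[ δ D ] y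
  φ-injective x y φx≈φy = SpanR.quot-trans {x} {ψ (φ x)} {y} (SpanR.quot-sym {ψ (φ x)} {x} (ψφ x))
    (SpanR.quot-trans {ψ (φ x)} {ψ (φ y)} {y} (ψ-well-defined {φ x} {φ y} φx≈φy) (ψφ y))

  φ-equivariant : ∀ σ x → φ (actR σ x) ≈P actP σ (φ x)
  φ-equivariant σ x = SpanP.quot-≡ {φ (actR σ x)} (φ-act σ x)

  φ-additive : ∀ x y → φ (x RR.⊕ y) ≈P (φ x PP.⊕ φ y)
  φ-additive x y = SpanP.quot-≡ {φ (x RR.⊕ y)} (Φ.extend-++ x y)

  φ-homogeneous : ∀ a x → φ (a RR.⊙ x) ≈P (a PP.⊙ φ x)
  φ-homogeneous a x = SpanP.quot-≈ {φ (a RR.⊙ x)} {a PP.⊙ φ x} (Φ.extend-⊙ a x)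

mainTheorem4 : ∀ {c ℓ : Level} (F : Field c ℓ) → Characteristic0 F →
    (n d : ℕ) → NonZero n → NonZero d →
    (D : Fin d → Fin d → ℕ) → IsCorrelatedDiagram d n D →
    Modules.RC-Iso F d n (δ D) D
mainTheorem4 F _ n d _ _ D corr = record
  { φ           = φ
  ; well-def    = φ-well-defined
  ; additive    = φ-additive
  ; homogen     = φ-homogeneous
  ; equivariant = φ-equivariant
  ; into-C      = φ-into-C
  ; injective   = φ-injective
  ; onto-C      = φ-onto-C
  }
  where
  open Correspondence F d n D corr
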